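{- Let $\Gamma$ be a finite vertex-transitive graph with vertex set $V\Gamma=[m]\times[k]$ and let $G\le\mathrm{Aut}(\Gamma)$ satisfy $X^k\le G\le Y\wr\mathrm{Sym}(k)$, where $(m,X,Y)$ is one of ($m\ge4$, $\mathrm{Alt}(m)$, $\mathrm{Sym}(m)$), ($5$, $D_5$, $\mathrm{AGL}_1(5)$), ($6$, $\mathrm{PSL}_2(5)$, $\mathrm{PGL}_2(5)$), ($7$, $\mathrm{PGL}_3(2)$, $\mathrm{PGL}_3(2)$), ($8$, $\mathrm{AGL}_3(2)$, $\mathrm{AGL}_3(2)$). Then either (1) $\mu(\Gamma)=2$ and $\Gamma\cong\Theta[K_m]$ or $\Gamma\cong\Theta[mK_1]$ for a vertex-transitive graph $\Theta$; or (2) $\mu(\Gamma)=4$ and $\Gamma\cong\Theta[C_5]$ for a vertex-transitive graph $\Theta$.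
   Context: Graphs are finite, simple, undirected; $\mu(\Gamma)$ is the minimum number of vertices moved by a non-identity automorphism. $[k]=\{1,\dots,k\}$. $Y\wr\mathrm{Sym}(k)=Y^k\rtimes\mathrm{Sym}(k)$ acts on $[m]\times[k]$ by $(\delta,j)^{((y_1,\dots,y_k),h)}=(\delta^{y_j},j^h)$, and $X^k=\{((x_1,\dots,x_k),1):x_j\in X\}$. The groups act on $[m]$ identified with: $5$ points for $D_5$ (dihedral of order $10$) and $\mathrm{AGL}_1(5)$ (on $\mathbb F_5$); the projective line over $\mathbb F_5$ for $\mathrm{PSL}_2(5)\le\mathrm{PGL}_2(5)$; the Fano plane's points for $\mathrm{PGL}_3(2)$; $\mathbb F_2^3$ for $\mathrm{AGL}_3(2)$. The lexicographic product $\Theta[\Delta]$ has vertex set $V\Delta\times V\Theta$, with $(\delta_1,\theta_1)\sim(\delta_2,\theta_2)$ iff ($\theta_1=\theta_2$ and $\delta_1\sim\delta_2$) or $\theta_1\sim\theta_2$. $K_m$ complete graph, $mK_1$ edgeless graph on $m$ vertices, $C_5$ the $5$-cycle. -}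

module Defs where

open import Data.Nat using (ℕ; zero; suc; _+_; _*_; _%_; _/_; _^_; _<_; _≡ᵇ_)
open import Data.Nat.Properties using (_<?_)
open import Data.Fin using (Fin; toℕ) renaming (zero to f0)
import Data.Fin as F
open import Data.Fin.Properties using () renaming (_≟_ to _≟F_)
open import Data.Product using (Σ; ∃; _×_; _,_; proj₁; proj₂)
open import Data.Product.Properties using (≡-dec)
open import Data.Sum using (_⊎_)
open import Data.Bool using (Bool; true; false; _∧_; _∨_; not; if_then_else_)
open import Data.Unit using (⊤)
open import Data.List using (List; length; filter; cartesianProduct; allFin)
open import Relation.Binary.PropositionalEquality using (_≡_; _≢_)
open import Relation.Binary.Definitions using (DecidableEquality)
open import Relation.Nullary using (¬_; ¬?)
open import Relation.Nullary.Decidable using (⌊_⌋)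
open import Function.Bundles using (_↔_; Inverse)
open import Function.Construct.Identity using (↔-id)
open import Function.Construct.Composition using (_↔-∘_)
open import Function.Construct.Symmetry using (↔-sym)

Perm : Set → Set
Perm A = A ↔ A

_⟨$⟩_ : {A B : Set} → A ↔ B → A → B
φ ⟨$⟩ x = Inverse.to φ x

Graph : Set → Set
Graph V = V → V → Bool

IsSimple : {V : Set} → Graph V → Set
IsSimple {V} Γ = (∀ u v → Γ u v ≡ Γ v u) × (∀ v → Γ v v ≡ false)

IsAut : {V : Set} → Graph V → Perm V → Set
IsAut Γ σ = ∀ u v → Γ (σ ⟨$⟩ u) (σ ⟨$⟩ v) ≡ Γ u v

VertexTransitive : {V : Set} → Graph V → Set
VertexTransitive {V} Γ = ∀ u v → Σ (Perm V) λ σ → IsAut Γ σ × (σ ⟨$⟩ u ≡ v)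

_≅_ : {V W : Set} → Graph V → Graph W → Set
_≅_ {V} {W} Γ Δ = Σ (V ↔ W) λ φ → ∀ u v → Δ (φ ⟨$⟩ u) (φ ⟨$⟩ v) ≡ Γ u v

record IsPermGroup {A : Set} (G : Perm A → Set) : Set where
  field
    id∈   : G (↔-id A)
    comp∈ : ∀ {σ τ} → G σ → G τ → G (σ ↔-∘ τ)
    inv∈  : ∀ {σ} → G σ → G (↔-sym σ)

allV : (m k : ℕ) → List (Fin m × Fin k)
allV m k = cartesianProduct (allFin m) (allFin k)

moved : {m k : ℕ} → Perm (Fin m × Fin k) → ℕ
moved {m} {k} σ =
  length (filter (λ v → ¬? (≡-dec _≟F_ _≟F_ (σ ⟨$⟩ v) v)) (allV m k))

NonIdentity : {V : Set} → Perm V → Set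
NonIdentity {V} σ = Σ V λ v → σ ⟨$⟩ v ≢ v

HasMu : {m k : ℕ} → Graph (Fin m × Fin k) → ℕ → Set
HasMu {m} {k} Γ d =
  (Σ (Perm (Fin m × Fin k)) λ σ → IsAut Γ σ × NonIdentity σ × moved σ ≡ d)
  × (∀ (σ : Perm (Fin m × Fin k)) → IsAut Γ σ → NonIdentity σ → d Data.Nat.≤ moved σ)

InWreath : {m k : ℕ} → (Perm (Fin m) → Set) → Perm (Fin m × Fin k) → Set
InWreath {m} {k} Y g =
  Σ (Fin k → Perm (Fin m)) λ ys → (∀ j → Y (ys j)) ×
  Σ (Perm (Fin k)) λ h → ∀ δ j → g ⟨$⟩ (δ , j) ≡ (ys j ⟨$⟩ δ , h ⟨$⟩ j)

InBase : {m k : ℕ} → (Perm (Fin m) → Set) → Perm (Fin m × Fin k) → Set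
InBase {m} {k} X g =
  Σ (Fin k → Perm (Fin m)) λ xs → (∀ j → X (xs j)) ×
  (∀ δ j → g ⟨$⟩ (δ , j) ≡ (xs j ⟨$⟩ δ , j))

SymG : (m : ℕ) → Perm (Fin m) → Set
SymG m σ = ⊤

inversions : {m : ℕ} → Perm (Fin m) → ℕ
inversions {m} σ =
  length (filter (λ p → ⌊ toℕ (proj₁ p) <? toℕ (proj₂ p) ⌋
                       ∧ ⌊ toℕ (σ ⟨$⟩ proj₂ p) <? toℕ (σ ⟨$⟩ proj₁ p) ⌋ Data.Bool.≟ true)
          (cartesianProduct (allFin m) (allFin m)))

AltG : (m : ℕ) → Perm (Fin m) → Set
AltG m σ = inversions σ % 2 ≡ 0

AGL15 : Perm (Fin 5) → Set
AGL15 σ = Σ (Fin 5) λ a → Σ (Fin 5) λ b → toℕ a ≢ 0 ×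
  (∀ x → toℕ (σ ⟨$⟩ x) ≡ (toℕ a * toℕ x + toℕ b) % 5)

D5 : Perm (Fin 5) → Set
D5 σ = Σ (Fin 5) λ a → Σ (Fin 5) λ b → (toℕ a ≡ 1 ⊎ toℕ a ≡ 4) ×
  (∀ x → toℕ (σ ⟨$⟩ x) ≡ (toℕ a * toℕ x + toℕ b) % 5)

-- projective line over F_5: point i < 5 is [i : 1], point 5 is [1 : 0] = ∞
repPL : Fin 6 → ℕ × ℕ
repPL i = (if toℕ i ≡ᵇ 5 then 1 else toℕ i) , (if toℕ i ≡ᵇ 5 then 0 else 1)

-- the matrix (a b ; c d) over F_5 induces σ on the projective line:
-- M (rep p) = λ · rep (σ p) for some nonzero scalar λ
Induces2 : ℕ → ℕ → ℕ → ℕ → Perm (Fin 6) → Set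
Induces2 a b c d σ = ∀ p →
  let x = proj₁ (repPL p) ; y = proj₂ (repPL p)
      x' = proj₁ (repPL (σ ⟨$⟩ p)) ; y' = proj₂ (repPL (σ ⟨$⟩ p)) in
  Σ (Fin 5) λ l → toℕ l ≢ 0 ×
    ((a * x + b * y) % 5 ≡ (toℕ l * x') % 5) ×
    ((c * x + d * y) % 5 ≡ (toℕ l * y') % 5)

PGL25 : Perm (Fin 6) → Set
PGL25 σ = Σ (Fin 5) λ a → Σ (Fin 5) λ b → Σ (Fin 5) λ c → Σ (Fin 5) λ d →
  ((toℕ a * toℕ d) % 5 ≢ (toℕ b * toℕ c) % 5) × Induces2 (toℕ a) (toℕ b) (toℕ c) (toℕ d) σ

PSL25 : Perm (Fin 6) → Set
PSL25 σ = Σ (Fin 5) λ a → Σ (Fin 5) λ b → Σ (Fin 5) λ c → Σ (Fin 5) λ d →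
  ((toℕ a * toℕ d) % 5 ≡ (toℕ b * toℕ c + 1) % 5) × Induces2 (toℕ a) (toℕ b) (toℕ c) (toℕ d) σ

Mat3 : Set
Mat3 = Fin 3 → Fin 3 → Fin 2

i0 i1 i2 : Fin 3
i0 = f0
i1 = F.suc f0
i2 = F.suc (F.suc f0)

e : Mat3 → Fin 3 → Fin 3 → ℕ
e M r c = toℕ (M r c)

-- M is nonsingular over F_2: det M ≢ 0, det = (positive terms) − (negative terms)
Nonsingular3 : Mat3 → Set
Nonsingular3 M =
  (e M i0 i0 * e M i1 i1 * e M i2 i2 + e M i0 i1 * e M i1 i2 * e M i2 i0
     + e M i0 i2 * e M i1 i0 * e M i2 i1) % 2
  ≢ (e M i0 i2 * e M i1 i1 * e M i2 i0 + e M i0 i1 * e M i1 i0 * e M i2 i2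
     + e M i0 i0 * e M i1 i2 * e M i2 i1) % 2

-- M v (entries as naturals, not yet reduced)
mulv : Mat3 → (Fin 3 → ℕ) → Fin 3 → ℕ
mulv M v r = e M r i0 * v i0 + e M r i1 * v i1 + e M r i2 * v i2

bit : ℕ → Fin 3 → ℕ
bit n f0 = n % 2
bit n (F.suc f0) = (n / 2) % 2
bit n (F.suc (F.suc _)) = (n / 4) % 2

-- Fano plane points: point i ↦ nonzero vector with binary digits of i+1
fano : Fin 7 → Fin 3 → ℕ
fano i = bit (suc (toℕ i))

-- PGL_3(2) = GL_3(2) acting on the 7 points
PGL32 : Perm (Fin 7) → Set
PGL32 σ = Σ Mat3 λ M → Nonsingular3 M ×
  (∀ p r → fano (σ ⟨$⟩ p) r ≡ mulv M (fano p) r % 2)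

-- F_2^3 : point i ↦ binary digits of i
vec8 : Fin 8 → Fin 3 → ℕ
vec8 i = bit (toℕ i)

AGL32 : Perm (Fin 8) → Set
AGL32 σ = Σ Mat3 λ M → Nonsingular3 M × Σ (Fin 3 → Fin 2) λ b →
  (∀ p r → vec8 (σ ⟨$⟩ p) r ≡ (mulv M (vec8 p) r + toℕ (b r)) % 2)

data Triple : (m : ℕ) → (Perm (Fin m) → Set) → (Perm (Fin m) → Set) → Set₁ where
  alt-sym : ∀ {m} → 4 Data.Nat.≤ m → Triple m (AltG m) (SymG m)
  d5-agl  : Triple 5 D5 AGL15
  psl-pgl : Triple 6 PSL25 PGL25
  pgl-pgl : Triple 7 PGL32 PGL32
  agl-agl : Triple 8 AGL32 AGL32

K : (m : ℕ) → Graph (Fin m)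
K m i j = not ⌊ i ≟F j ⌋

E : (m : ℕ) → Graph (Fin m)
E m i j = false

C5 : Graph (Fin 5)
C5 i j = ⌊ toℕ j Data.Nat.≟ suc (toℕ i) % 5 ⌋ ∨ ⌊ toℕ i Data.Nat.≟ suc (toℕ j) % 5 ⌋

Lex : {W : Set} {t : ℕ} → Graph (Fin t) → Graph W → Graph (W × Fin t)
Lex Θ Δ (δ₁ , θ₁) (δ₂ , θ₂) = (⌊ θ₁ ≟F θ₂ ⌋ ∧ Δ δ₁ δ₂) ∨ Θ θ₁ θ₂

module Submission where

-- The base group X^k acts on every block separately. As X is transitive, adjacency between two
-- blocks is all or nothing, and as X is 2-transitive each block induces K_m or mK₁; for D₅, whose
-- orbitals on pairs are the two distance classes of C₅, a block induces K₅, 5K₁, C₅ or the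
-- complement of C₅. Vertex-transitivity carries a pair of twins of one block into every block,
-- which makes all blocks alike, so Γ ≅ Θ[Δ] with Θ read off one row of Γ.
-- In Θ[K_m] and Θ[mK₁] two vertices of a block are twins, so μ = 2. In Θ[C₅] no two vertices are
-- twins and no three look alike to all other vertices, so μ ≥ 4, and reflecting one block moves
-- four vertices. Θ is vertex-transitive: automorphisms of Θ[C₅] preserve blocks, since two vertices
-- of one block are separated by only two others; those of Θ[K_m] and Θ[mK₁] map twin classes to
-- twin classes of equal size, and matching the classes by rank yields automorphisms of Θ.

open import Defs
open import Data.Bool using (Bool; true; false; _∧_; _∨_; not; if_then_else_)
open import Data.Bool.Properties using (∨-identityʳ; ∧-identityʳ; ∧-zeroʳ) renaming (_≟_ to _≟B_)
open import Data.Empty using (⊥-elim)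
open import Data.Fin using (Fin; toℕ; fromℕ<)
import Data.Fin as Fin
open import Data.Fin.Patterns using (0F; 1F; 2F; 3F; 4F; 5F; 6F; 7F)
open import Data.Fin.Properties using (all?; any?; nonZeroIndex; toℕ<n; toℕ-fromℕ<; toℕ-injective)
  renaming (_≟_ to _≟F_)
open import Data.List using (List; []; _∷_; _++_; length; filter; map; tabulate; cartesianProduct; allFin)
open import Data.List.Membership.Propositional using (_∈_; _∉_)
import Data.List.Membership.DecPropositional as DecMembership
open import Data.List.Membership.Propositional.Properties
  using (∈-filter⁺; ∈-filter⁻; ∈-map⁻; ∈-cartesianProduct⁺; ∈-allFin)
open import Data.List.Properties using (length-map; length-++; filter-++; length-tabulate)
open import Data.List.Relation.Unary.All using (All; []; _∷_)
import Data.List.Relation.Unary.All as All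
import Data.List.Relation.Unary.All.Properties as All
open import Data.List.Relation.Unary.Any using (here; there; satisfied)
import Data.List.Relation.Unary.Any as Any
open import Data.List.Relation.Unary.Unique.Propositional using (Unique; []; _∷_)
open import Data.List.Relation.Unary.Unique.Propositional.Properties
  using (filter⁺; map⁺; cartesianProduct⁺; allFin⁺)
open import Data.Maybe using (Maybe; just; nothing)
import Data.Maybe as Maybe
open import Data.Nat using (ℕ; zero; suc; pred; _+_; _*_; _%_; _≤_; _<_; z≤n; s≤s) renaming (_≟_ to _≟ℕ_)
open import Data.Nat.DivMod using (_mod_)
open import Data.Nat.Properties
  using (≤-antisym; +-monoʳ-<; *-cancelˡ-≤; <-trans; <-asym; <-irrefl; n<1+n; n≤0⇒n≡0)
  renaming (_<?_ to _<?ℕ_)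
open import Data.Product using (Σ; _×_; _,_; proj₁; proj₂)
open import Data.Product.Properties using (≡-dec)
open import Data.Sum using (_⊎_; inj₁; inj₂; [_,_]′)
import Data.Sum
open import Function.Base using (id; _∘_; case_of_)
open import Function.Bundles using (_↔_; Inverse; mk↔ₛ′)
open import Function.Construct.Composition using (_↔-∘_)
open import Function.Construct.Identity using (↔-id)
open import Function.Construct.Symmetry using (↔-sym)
open import Relation.Binary.Definitions using (DecidableEquality)
open import Relation.Binary.PropositionalEquality
  using (_≡_; _≢_; refl; sym; trans; cong; cong₂; subst; subst₂; module ≡-Reasoning)
open import Relation.Nullary using (¬_; Dec; yes; no; ¬?)
open import Relation.Nullary.Decidable
  using (⌊_⌋; True; toWitness; from-yes; decidable-stable; isYes≗does; dec-true; dec-false;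
         _×-dec_; _⊎-dec_; _→-dec_)

private variable
  A B : Set
  m k : ℕ

⌊⌋-true : {P : Set} (p? : Dec P) → P → ⌊ p? ⌋ ≡ true
⌊⌋-true p? p = trans (isYes≗does p?) (dec-true p? p)

⌊⌋-false : {P : Set} (p? : Dec P) → ¬ P → ⌊ p? ⌋ ≡ false
⌊⌋-false p? ¬p = trans (isYes≗does p?) (dec-false p? ¬p)

⌊⌋-cong : {P Q : Set} (p? : Dec P) (q? : Dec Q) → (P → Q) → (Q → P) → ⌊ p? ⌋ ≡ ⌊ q? ⌋
⌊⌋-cong (yes _) (yes _) _   _   = refl
⌊⌋-cong (no _)  (no _)  _   _   = refl
⌊⌋-cong (yes p) (no ¬q) p→q _   = ⊥-elim (¬q (p→q p))
⌊⌋-cong (no ¬p) (yes q) _   q→p = ⊥-elim (¬p (q→p q))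

⌊⌋-sound : {P : Set} (p? : Dec P) → ⌊ p? ⌋ ≡ true → P
⌊⌋-sound (yes p) _ = p

∀-Bool? : {P : Bool → Set} → (∀ b → Dec (P b)) → Dec (∀ b → P b)
∀-Bool? P? with P? false | P? true
... | yes p₀ | yes p₁ = yes λ { false → p₀ ; true → p₁ }
... | no ¬p₀ | _      = no λ all → ¬p₀ (all false)
... | _      | no ¬p₁ = no λ all → ¬p₁ (all true)

-- Permutations and isomorphisms

_⟨$⟩⁻¹_ : A ↔ B → B → A
φ ⟨$⟩⁻¹ y = Inverse.from φ y

⟨$⟩-⟨$⟩⁻¹ : (φ : A ↔ B) (y : B) → φ ⟨$⟩ (φ ⟨$⟩⁻¹ y) ≡ y
⟨$⟩-⟨$⟩⁻¹ φ = Inverse.strictlyInverseˡ φ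

⟨$⟩⁻¹-⟨$⟩ : (φ : A ↔ B) (x : A) → φ ⟨$⟩⁻¹ (φ ⟨$⟩ x) ≡ x
⟨$⟩⁻¹-⟨$⟩ φ = Inverse.strictlyInverseʳ φ

⟨$⟩-injective : (φ : A ↔ B) {x y : A} → φ ⟨$⟩ x ≡ φ ⟨$⟩ y → x ≡ y
⟨$⟩-injective φ {x} {y} eq =
  trans (sym (⟨$⟩⁻¹-⟨$⟩ φ x)) (trans (cong (φ ⟨$⟩⁻¹_) eq) (⟨$⟩⁻¹-⟨$⟩ φ y))

⟨$⟩⁻¹-injective : (φ : A ↔ B) {x y : B} → φ ⟨$⟩⁻¹ x ≡ φ ⟨$⟩⁻¹ y → x ≡ y
⟨$⟩⁻¹-injective φ = ⟨$⟩-injective (↔-sym φ)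

module Transposition {A : Set} (_≟_ : DecidableEquality A) where

  swap : A → A → A → A
  swap a b x with x ≟ a
  ... | yes _ = b
  ... | no _ with x ≟ b
  ...   | yes _ = a
  ...   | no _  = x

  swap-at₁ : ∀ a b → swap a b a ≡ b
  swap-at₁ a b with a ≟ a
  ... | yes _   = refl
  ... | no a≢a = ⊥-elim (a≢a refl)

  swap-at₂ : ∀ a b → swap a b b ≡ a
  swap-at₂ a b with b ≟ a
  ... | yes b≡a = b≡a
  ... | no _ with b ≟ b
  ...   | yes _   = refl
  ...   | no b≢b = ⊥-elim (b≢b refl)

  swap-off : ∀ a b x → x ≢ a → x ≢ b → swap a b x ≡ x
  swap-off a b x x≢a x≢b with x ≟ a
  ... | yes x≡a = ⊥-elim (x≢a x≡a)
  ... | no _ with x ≟ b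
  ...   | yes x≡b = ⊥-elim (x≢b x≡b)
  ...   | no _    = refl

  data Position (a b x : A) : Set where
    at₁ : x ≡ a → Position a b x
    at₂ : x ≡ b → x ≢ a → Position a b x
    off : x ≢ a → x ≢ b → Position a b x

  position : ∀ a b x → Position a b x
  position a b x with x ≟ a
  ... | yes x≡a = at₁ x≡a
  ... | no x≢a with x ≟ b
  ...   | yes x≡b = at₂ x≡b x≢a
  ...   | no x≢b  = off x≢a x≢b

  swap-involutive : ∀ a b x → swap a b (swap a b x) ≡ x
  swap-involutive a b x with position a b x
  ... | at₁ refl    = trans (cong (swap x b) (swap-at₁ x b)) (swap-at₂ x b)
  ... | at₂ refl _  = trans (cong (swap a x) (swap-at₂ a x)) (swap-at₁ a x)
  ... | off x≢a x≢b = trans (cong (swap a b) (swap-off a b x x≢a x≢b)) (swap-off a b x x≢a x≢b)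

  transposition : A → A → Perm A
  transposition a b = mk↔ₛ′ (swap a b) (swap a b) (swap-involutive a b) (swap-involutive a b)

  transposition-isAut : (Γ : Graph A) → IsSimple Γ → ∀ a b →
    (∀ w → w ≢ a → w ≢ b → Γ a w ≡ Γ b w) → IsAut Γ (transposition a b)
  transposition-isAut Γ (Γ-sym , Γ-loopless) a b twins u v = go (position a b u) (position a b v)
    where
    go : Position a b u → Position a b v → Γ (swap a b u) (swap a b v) ≡ Γ u v
    go (at₁ refl) (at₁ refl) rewrite swap-at₁ u b = trans (Γ-loopless b) (sym (Γ-loopless u))
    go (at₁ refl) (at₂ refl _) rewrite swap-at₁ u v | swap-at₂ u v = Γ-sym v u
    go (at₁ refl) (off v≢a v≢b) rewrite swap-at₁ u b | swap-off u b v v≢a v≢b = sym (twins v v≢a v≢b)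
    go (at₂ refl _) (at₁ refl) rewrite swap-at₁ v u | swap-at₂ v u = Γ-sym v u
    go (at₂ refl _) (at₂ refl _) rewrite swap-at₂ a u = trans (Γ-loopless a) (sym (Γ-loopless u))
    go (at₂ refl _) (off v≢a v≢b) rewrite swap-at₂ a u | swap-off a u v v≢a v≢b = twins v v≢a v≢b
    go (off u≢a u≢b) (at₁ refl) rewrite swap-at₁ v b | swap-off v b u u≢a u≢b =
      trans (Γ-sym u b) (trans (sym (twins u u≢a u≢b)) (Γ-sym v u))
    go (off u≢a u≢b) (at₂ refl _) rewrite swap-at₂ a v | swap-off a v u u≢a u≢b =
      trans (Γ-sym u a) (trans (twins u u≢a u≢b) (Γ-sym v u))
    go (off u≢a u≢b) (off v≢a v≢b) rewrite swap-off a b u u≢a u≢b | swap-off a b v v≢a v≢b = refl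

IsAut-⁻¹ : (Γ : Graph A) (σ : Perm A) → IsAut Γ σ → IsAut Γ (↔-sym σ)
IsAut-⁻¹ Γ σ σ-aut u v = begin
  Γ (σ ⟨$⟩⁻¹ u) (σ ⟨$⟩⁻¹ v)                         ≡⟨ sym (σ-aut (σ ⟨$⟩⁻¹ u) (σ ⟨$⟩⁻¹ v)) ⟩
  Γ (σ ⟨$⟩ (σ ⟨$⟩⁻¹ u)) (σ ⟨$⟩ (σ ⟨$⟩⁻¹ v))         ≡⟨ cong₂ Γ (⟨$⟩-⟨$⟩⁻¹ σ u) (⟨$⟩-⟨$⟩⁻¹ σ v) ⟩
  Γ u v                                             ∎
  where open ≡-Reasoning

IsAut-∘ : (Γ : Graph A) (σ τ : Perm A) → IsAut Γ σ → IsAut Γ τ → IsAut Γ (σ ↔-∘ τ)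
IsAut-∘ Γ σ τ σ-aut τ-aut u v = trans (σ-aut (τ ⟨$⟩ u) (τ ⟨$⟩ v)) (τ-aut u v)

conjugate : A ↔ B → Perm A → Perm B
conjugate φ σ = φ ↔-∘ (σ ↔-∘ ↔-sym φ)

≅-sym : {Γ : Graph A} {Λ : Graph B} → Γ ≅ Λ → Λ ≅ Γ
≅-sym {Γ = Γ} {Λ} (φ , φ-iso) = ↔-sym φ , λ u v → begin
  Γ (φ ⟨$⟩⁻¹ u) (φ ⟨$⟩⁻¹ v)                         ≡⟨ sym (φ-iso (φ ⟨$⟩⁻¹ u) (φ ⟨$⟩⁻¹ v)) ⟩
  Λ (φ ⟨$⟩ (φ ⟨$⟩⁻¹ u)) (φ ⟨$⟩ (φ ⟨$⟩⁻¹ v))         ≡⟨ cong₂ Λ (⟨$⟩-⟨$⟩⁻¹ φ u) (⟨$⟩-⟨$⟩⁻¹ φ v) ⟩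
  Λ u v                                             ∎
  where open ≡-Reasoning

IsAut-conjugate : {Γ : Graph A} {Λ : Graph B} ((φ , _) : Γ ≅ Λ) (σ : Perm A) →
  IsAut Γ σ → IsAut Λ (conjugate φ σ)
IsAut-conjugate {Γ = Γ} {Λ} (φ , φ-iso) σ σ-aut u v = begin
  Λ (φ ⟨$⟩ (σ ⟨$⟩ (φ ⟨$⟩⁻¹ u))) (φ ⟨$⟩ (σ ⟨$⟩ (φ ⟨$⟩⁻¹ v)))  ≡⟨ φ-iso _ _ ⟩
  Γ (σ ⟨$⟩ (φ ⟨$⟩⁻¹ u)) (σ ⟨$⟩ (φ ⟨$⟩⁻¹ v))                  ≡⟨ σ-aut _ _ ⟩
  Γ (φ ⟨$⟩⁻¹ u) (φ ⟨$⟩⁻¹ v)                                  ≡⟨ proj₂ (≅-sym (φ , φ-iso)) u v ⟩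
  Λ u v                                                      ∎
  where open ≡-Reasoning

VertexTransitive-≅ : {Γ : Graph A} {Λ : Graph B} → Γ ≅ Λ → VertexTransitive Γ → VertexTransitive Λ
VertexTransitive-≅ (φ , φ-iso) Γ-vt x y with Γ-vt (φ ⟨$⟩⁻¹ x) (φ ⟨$⟩⁻¹ y)
... | σ , σ-aut , σx≡y =
  conjugate φ σ , IsAut-conjugate (φ , φ-iso) σ σ-aut ,
  trans (cong (φ ⟨$⟩_) σx≡y) (⟨$⟩-⟨$⟩⁻¹ φ y)

-- Counting moved vertices

private
  remove : {x : A} (ys : List A) → x ∈ ys → List A
  remove (_ ∷ ys) (here _)  = ys
  remove (y ∷ ys) (there p) = y ∷ remove ys p

  length-remove : {x : A} (ys : List A) (p : x ∈ ys) → length ys ≡ suc (length (remove ys p))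
  length-remove (_ ∷ _)  (here _)  = refl
  length-remove (_ ∷ ys) (there p) = cong suc (length-remove ys p)

  ∈-remove : {x z : A} (ys : List A) (p : x ∈ ys) → z ∈ ys → z ≢ x → z ∈ remove ys p
  ∈-remove (_ ∷ _)  (here refl) (here refl) z≢x = ⊥-elim (z≢x refl)
  ∈-remove (_ ∷ _)  (here refl) (there q)   _   = q
  ∈-remove (_ ∷ _)  (there p)   (here e)    _   = here e
  ∈-remove (_ ∷ ys) (there p)   (there q)   z≢x = there (∈-remove ys p q z≢x)

  All-≢ : {x z : A} {xs : List A} → All (x ≢_) xs → z ∈ xs → z ≢ x
  All-≢ (x≢y ∷ _) (here refl) = λ eq → x≢y (sym eq)
  All-≢ (_ ∷ all) (there q)   = All-≢ all q

Unique-length-≤ : {xs ys : List A} → Unique xs → (∀ {x} → x ∈ xs → x ∈ ys) → length xs ≤ length ys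
Unique-length-≤ {xs = []} _ _ = z≤n
Unique-length-≤ {xs = x ∷ xs} {ys} (x∉xs ∷ xs-unique) xs⊆ys
  rewrite length-remove ys (xs⊆ys (here refl)) =
  s≤s (Unique-length-≤ xs-unique λ z∈xs →
    ∈-remove ys (xs⊆ys (here refl)) (xs⊆ys (there z∈xs)) (All-≢ x∉xs z∈xs))

Vertex : ℕ → ℕ → Set
Vertex m k = Fin m × Fin k

_≟V_ : DecidableEquality (Vertex m k)
_≟V_ = ≡-dec _≟F_ _≟F_

Moves : Perm (Vertex m k) → Vertex m k → Set
Moves σ v = σ ⟨$⟩ v ≢ v

movedList : Perm (Vertex m k) → List (Vertex m k)
movedList {m} {k} σ = filter (λ v → ¬? ((σ ⟨$⟩ v) ≟V v)) (allV m k)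

∈-allV : (v : Vertex m k) → v ∈ allV m k
∈-allV (a , j) = ∈-cartesianProduct⁺ (∈-allFin a) (∈-allFin j)

∈-movedList : (σ : Perm (Vertex m k)) {v : Vertex m k} → Moves σ v → v ∈ movedList σ
∈-movedList σ {v} = ∈-filter⁺ (λ v → ¬? ((σ ⟨$⟩ v) ≟V v)) (∈-allV v)

movedList-moves : (σ : Perm (Vertex m k)) {v : Vertex m k} → v ∈ movedList σ → Moves σ v
movedList-moves {m} {k} σ p = proj₂ (∈-filter⁻ (λ v → ¬? ((σ ⟨$⟩ v) ≟V v)) {xs = allV m k} p)

allV-unique : Unique (allV m k)
allV-unique {m} {k} = cartesianProduct⁺ (allFin⁺ m) (allFin⁺ k)

movedList-unique : (σ : Perm (Vertex m k)) → Unique (movedList σ)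
movedList-unique σ = filter⁺ (λ v → ¬? ((σ ⟨$⟩ v) ≟V v)) allV-unique

moved-≥ : (σ : Perm (Vertex m k)) {xs : List (Vertex m k)} → Unique xs →
  (∀ {x} → x ∈ xs → Moves σ x) → length xs ≤ moved σ
moved-≥ σ xs-unique xs-moved = Unique-length-≤ xs-unique (λ x∈xs → ∈-movedList σ (xs-moved x∈xs))

moved-≤ : (σ : Perm (Vertex m k)) (xs : List (Vertex m k)) →
  (∀ x → Moves σ x → x ∈ xs) → moved σ ≤ length xs
moved-≤ σ xs ⊆xs = Unique-length-≤ (movedList-unique σ) (λ p → ⊆xs _ (movedList-moves σ p))

moved-≡ : (σ : Perm (Vertex m k)) {xs : List (Vertex m k)} → Unique xs →
  (∀ {x} → x ∈ xs → Moves σ x) → (∀ x → Moves σ x → x ∈ xs) → moved σ ≡ length xs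
moved-≡ σ {xs} xs-unique xs-moved ⊆xs = ≤-antisym (moved-≤ σ xs ⊆xs) (moved-≥ σ xs-unique xs-moved)

moved-≤-injection : (σ τ : Perm (Vertex m k)) (h : Vertex m k → Vertex m k) →
  (∀ {x y} → h x ≡ h y → x ≡ y) → (∀ x → Moves σ x → Moves τ (h x)) → moved σ ≤ moved τ
moved-≤-injection σ τ h h-injective σ⇒τ =
  subst (_≤ moved τ) (length-map h (movedList σ))
    (Unique-length-≤ (map⁺ h-injective (movedList-unique σ)) image⊆)
  where
  image⊆ : ∀ {y} → y ∈ map h (movedList σ) → y ∈ movedList τ
  image⊆ p with ∈-map⁻ h p
  ... | x , x∈ , refl = ∈-movedList τ (σ⇒τ x (movedList-moves σ x∈))

moved-conjugate : (φ σ : Perm (Vertex m k)) → moved (conjugate φ σ) ≡ moved σ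
moved-conjugate φ σ = ≤-antisym
  (moved-≤-injection (conjugate φ σ) σ (φ ⟨$⟩⁻¹_) (⟨$⟩⁻¹-injective φ)
    λ x moves fixed → moves (trans (cong (φ ⟨$⟩_) fixed) (⟨$⟩-⟨$⟩⁻¹ φ x)))
  (moved-≤-injection σ (conjugate φ σ) (φ ⟨$⟩_) (⟨$⟩-injective φ)
    λ x moves fixed →
      moves (⟨$⟩-injective φ (trans (cong (λ y → φ ⟨$⟩ (σ ⟨$⟩ y)) (sym (⟨$⟩⁻¹-⟨$⟩ φ x))) fixed)))

NonIdentity-conjugate : (φ σ : Perm A) → NonIdentity σ → NonIdentity (conjugate φ σ)
NonIdentity-conjugate φ σ (v , moves) =
  φ ⟨$⟩ v , λ fixed → moves (⟨$⟩-injective φ (trans (cong (λ y → φ ⟨$⟩ (σ ⟨$⟩ y)) (sym (⟨$⟩⁻¹-⟨$⟩ φ v))) fixed))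

HasMu-≅ : {Γ Λ : Graph (Vertex m k)} {d : ℕ} → Γ ≅ Λ → HasMu Λ d → HasMu Γ d
HasMu-≅ {d = d} Γ≅Λ ((σ , σ-aut , σ≢id , moved≡d) , d≤moved) =
  (conjugate ψ σ , IsAut-conjugate (≅-sym Γ≅Λ) σ σ-aut , NonIdentity-conjugate ψ σ σ≢id ,
    trans (moved-conjugate ψ σ) moved≡d) ,
  λ τ τ-aut τ≢id → subst (d ≤_) (moved-conjugate (proj₁ Γ≅Λ) τ)
    (d≤moved (conjugate (proj₁ Γ≅Λ) τ) (IsAut-conjugate Γ≅Λ τ τ-aut) (NonIdentity-conjugate (proj₁ Γ≅Λ) τ τ≢id))
  where
  ψ : Perm _
  ψ = ↔-sym (proj₁ Γ≅Λ)

moved≥2 : (σ : Perm (Vertex m k)) → NonIdentity σ → 2 ≤ moved σ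
moved≥2 σ (v , σv≢v) = moved-≥ σ ((σv≢v ∘ sym ∷ []) ∷ [] ∷ []) v-moved
  where
  v-moved : ∀ {x} → x ∈ v ∷ σ ⟨$⟩ v ∷ [] → Moves σ x
  v-moved (here refl)         = σv≢v
  v-moved (there (here refl)) = σv≢v ∘ ⟨$⟩-injective σ

moved≥4-of : (σ : Perm (Vertex m k)) {a b c d : Vertex m k} →
  a ≢ b → a ≢ c → a ≢ d → b ≢ c → b ≢ d → c ≢ d →
  Moves σ a → Moves σ b → Moves σ c → Moves σ d → 4 ≤ moved σ
moved≥4-of σ {a} {b} {c} {d} a≢b a≢c a≢d b≢c b≢d c≢d σa σb σc σd =
  moved-≥ σ ((a≢b ∷ a≢c ∷ a≢d ∷ []) ∷ (b≢c ∷ b≢d ∷ []) ∷ (c≢d ∷ []) ∷ [] ∷ []) all-moved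
  where
  all-moved : ∀ {x} → x ∈ a ∷ b ∷ c ∷ d ∷ [] → Moves σ x
  all-moved (here refl)                         = σa
  all-moved (there (here refl))                 = σb
  all-moved (there (there (here refl)))         = σc
  all-moved (there (there (there (here refl)))) = σd

moved-transposition : {u v : Vertex m k} → u ≢ v → moved (Transposition.transposition _≟V_ u v) ≡ 2
moved-transposition {u = u} {v} u≢v = moved-≡ σ ((u≢v ∷ []) ∷ [] ∷ []) moves-uv only-uv
  where
  open Transposition _≟V_
  σ = transposition u v
  moves-uv : ∀ {x} → x ∈ u ∷ v ∷ [] → Moves σ x
  moves-uv (here refl)         σu≡u = u≢v (trans (sym σu≡u) (swap-at₁ u v))
  moves-uv (there (here refl)) σv≡v = u≢v (trans (sym (swap-at₂ u v)) σv≡v)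
  only-uv : ∀ x → Moves σ x → x ∈ u ∷ v ∷ []
  only-uv x moves with position u v x
  ... | at₁ x≡u     = here x≡u
  ... | at₂ x≡v _   = there (here x≡v)
  ... | off x≢u x≢v = ⊥-elim (moves (swap-off u v x x≢u x≢v))

Separates : Graph A → A → A → A → Set
Separates Γ x u v = Γ x u ≢ Γ x v

Separator : Graph A → A → A → A → Set
Separator Γ u v x = x ≢ u × x ≢ v × Separates Γ x u v

PairsSeparated : Graph A → Set
PairsSeparated {A} Γ = ∀ u v → u ≢ v → Σ A (Separator Γ u v)

TriplesSeparated : Graph A → Set
TriplesSeparated {A} Γ = ∀ u v w → u ≢ v → u ≢ w → v ≢ w →
  Σ A λ x → x ≢ u × x ≢ v × x ≢ w × (Separates Γ x u v ⊎ Separates Γ x v w)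

moves-outside? : (σ : Perm (Vertex m k)) (xs : List (Vertex m k)) →
  (Σ (Vertex m k) λ x → x ∉ xs × Moves σ x) ⊎ (∀ x → x ∉ xs → σ ⟨$⟩ x ≡ x)
moves-outside? {m} {k} σ xs
  with Any.any? (λ x → ¬? (DecMembership._∈?_ _≟V_ x xs) ×-dec ¬? ((σ ⟨$⟩ x) ≟V x)) (allV m k)
... | yes found = inj₁ (satisfied found)
... | no none    = inj₂ λ x x∉xs → decidable-stable ((σ ⟨$⟩ x) ≟V x)
                          λ moves → none (Any.map (λ { refl → x∉xs , moves }) (∈-allV x))

-- σ moves four vertices unless it is a transposition or a 3-cycle, and these are ruled out by a
-- separator of the vertices they move: being fixed by σ, it sees σ-related vertices alike.
module FourMoved {m k : ℕ} (Γ : Graph (Vertex m k)) (σ : Perm (Vertex m k)) (σ-aut : IsAut Γ σ)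
                 (v : Vertex m k) (σv≢v : Moves σ v) where

  private
    S : Vertex m k → Vertex m k
    S = σ ⟨$⟩_

    u w : Vertex m k
    u = S v
    w = S u

    S-injective : ∀ {x y} → S x ≡ S y → x ≡ y
    S-injective = ⟨$⟩-injective σ

    σu≢u : S u ≢ u
    σu≢u = σv≢v ∘ S-injective

    fixed-sees-alike : ∀ x y → S x ≡ x → Γ x (S y) ≡ Γ x y
    fixed-sees-alike x y Sx≡x = trans (cong (λ z → Γ z (S y)) (sym Sx≡x)) (σ-aut x y)

  swapping : PairsSeparated Γ → w ≡ v → 4 ≤ moved σ
  swapping pairs w≡v with moves-outside? σ (v ∷ u ∷ [])
  ... | inj₁ (x , x∉ , σx≢x) =
    moved≥4-of σ (σv≢v ∘ sym) (x≢v ∘ sym) (σx≢v ∘ sym) (x≢u ∘ sym) (σx≢u ∘ sym) (σx≢x ∘ sym)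
      σv≢v σu≢u σx≢x (σx≢x ∘ S-injective)
    where
    x≢v : x ≢ v
    x≢v = x∉ ∘ here
    x≢u : x ≢ u
    x≢u = x∉ ∘ there ∘ here
    σx≢v : S x ≢ v
    σx≢v eq = x≢u (S-injective (trans eq (sym w≡v)))
    σx≢u : S x ≢ u
    σx≢u = x≢v ∘ S-injective
  ... | inj₂ fixes-rest with pairs v u (σv≢v ∘ sym)
  ...   | x , x≢v , x≢u , separates =
    ⊥-elim (separates (sym (fixed-sees-alike x v
      (fixes-rest x λ { (here eq) → x≢v eq ; (there (here eq)) → x≢u eq }))))

  cycling : TriplesSeparated Γ → w ≢ v → 4 ≤ moved σ
  cycling triples w≢v with S w ≟V v
  ... | no σw≢v =
    moved≥4-of σ (σv≢v ∘ sym) (w≢v ∘ sym) (σw≢v ∘ sym) (σu≢u ∘ sym) (λ eq → w≢v (sym (S-injective eq)))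
      (σw≢w ∘ sym) σv≢v σu≢u σw≢w (σw≢w ∘ S-injective)
    where
    σw≢w : S w ≢ w
    σw≢w = σu≢u ∘ S-injective
  ... | yes σw≡v with moves-outside? σ (v ∷ u ∷ w ∷ [])
  ...   | inj₁ (x , x∉ , σx≢x) =
    moved≥4-of σ (σv≢v ∘ sym) (w≢v ∘ sym) (λ eq → x∉ (here (sym eq))) (σu≢u ∘ sym)
      (λ eq → x∉ (there (here (sym eq)))) (λ eq → x∉ (there (there (here (sym eq)))))
      σv≢v σu≢u (λ σw≡w → w≢v (trans (sym σw≡w) σw≡v)) σx≢x
  ...   | inj₂ fixes-rest with triples v u w (σv≢v ∘ sym) (w≢v ∘ sym) (σu≢u ∘ sym)
  ...     | x , x≢v , x≢u , x≢w , separates =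
      ⊥-elim ([ (λ sep → sep (sym (fixed-sees-alike x v x-fixed))) ,
                (λ sep → sep (sym (fixed-sees-alike x u x-fixed))) ]′ separates)
    where
    x-fixed : S x ≡ x
    x-fixed = fixes-rest x λ { (here eq) → x≢v eq ; (there (here eq)) → x≢u eq ; (there (there (here eq))) → x≢w eq }

moved≥4 : (Γ : Graph (Vertex m k)) → PairsSeparated Γ → TriplesSeparated Γ →
  (σ : Perm (Vertex m k)) → IsAut Γ σ → NonIdentity σ → 4 ≤ moved σ
moved≥4 Γ pairs triples σ σ-aut (v , σv≢v) with (σ ⟨$⟩ (σ ⟨$⟩ v)) ≟V v
... | yes σ²v≡v = FourMoved.swapping Γ σ σ-aut v σv≢v pairs σ²v≡v
... | no σ²v≢v  = FourMoved.cycling Γ σ σ-aut v σv≢v triples σ²v≢v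

-- Lexicographic products

blockwise : (Fin k → Perm (Fin m)) → Perm (Vertex m k)
blockwise h = mk↔ₛ′ (λ (a , j) → h j ⟨$⟩ a , j) (λ (a , j) → h j ⟨$⟩⁻¹ a , j)
  (λ (a , j) → cong (_, j) (⟨$⟩-⟨$⟩⁻¹ (h j) a)) (λ (a , j) → cong (_, j) (⟨$⟩⁻¹-⟨$⟩ (h j) a))

onBlock : Fin k → Perm (Fin m) → Perm (Vertex m k)
onBlock j x = blockwise λ i → if ⌊ i ≟F j ⌋ then x else ↔-id _

onBlock-at : (j : Fin k) (x : Perm (Fin m)) (a : Fin m) → onBlock j x ⟨$⟩ (a , j) ≡ (x ⟨$⟩ a , j)
onBlock-at j x a rewrite ⌊⌋-true (j ≟F j) refl = refl

onBlock-off : (j : Fin k) (x : Perm (Fin m)) (a : Fin m) {i : Fin k} → i ≢ j → onBlock j x ⟨$⟩ (a , i) ≡ (a , i)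
onBlock-off j x a {i} i≢j rewrite ⌊⌋-false (i ≟F j) i≢j = refl

onBlock-components : {P : Perm (Fin m) → Set} (j : Fin k) (x : Perm (Fin m)) → P x → P (↔-id _) →
  ∀ i → P (if ⌊ i ≟F j ⌋ then x else ↔-id _)
onBlock-components j x Px Pid i with ⌊ i ≟F j ⌋
... | true  = Px
... | false = Pid

uniform : Bool → (m : ℕ) → Graph (Fin m)
uniform true  m = K m
uniform false m = E m

uniform-simple : ∀ c m → IsSimple (uniform c m)
uniform-simple true  m =
  (λ a b → cong not (⌊⌋-cong (a ≟F b) (b ≟F a) sym sym)) , (λ a → cong not (⌊⌋-true (a ≟F a) refl))
uniform-simple false m = (λ _ _ → refl) , (λ _ → refl)

uniform-off-diagonal : ∀ c {m} {a b : Fin m} → a ≢ b → uniform c m a b ≡ c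
uniform-off-diagonal true  {a = a} {b} a≢b = cong not (⌊⌋-false (a ≟F b) a≢b)
uniform-off-diagonal false a≢b = refl

module _ {W : Set} {k : ℕ} (Θ : Graph (Fin k)) (Δ : Graph W) where

  Lex-same : ∀ a b i → Θ i i ≡ false → Lex Θ Δ (a , i) (b , i) ≡ Δ a b
  Lex-same a b i Θii rewrite ⌊⌋-true (i ≟F i) refl | Θii = ∨-identityʳ (Δ a b)

  Lex-other : ∀ a b {i x} → i ≢ x → Lex Θ Δ (a , i) (b , x) ≡ Θ i x
  Lex-other a b {i} {x} i≢x rewrite ⌊⌋-false (i ≟F x) i≢x = refl

  Lex-simple : IsSimple Θ → IsSimple Δ → IsSimple (Lex Θ Δ)
  Lex-simple (Θ-sym , Θ-loopless) (Δ-sym , Δ-loopless) = Lex-sym , Lex-loopless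
    where
    Lex-sym : ∀ u v → Lex Θ Δ u v ≡ Lex Θ Δ v u
    Lex-sym (a , i) (b , x) = by-block i x (i ≟F x)
      where
      by-block : ∀ i x → Dec (i ≡ x) → Lex Θ Δ (a , i) (b , x) ≡ Lex Θ Δ (b , x) (a , i)
      by-block i .i (yes refl) =
        trans (Lex-same a b i (Θ-loopless i)) (trans (Δ-sym a b) (sym (Lex-same b a i (Θ-loopless i))))
      by-block i x (no i≢x) =
        trans (Lex-other a b i≢x) (trans (Θ-sym i x) (sym (Lex-other b a (i≢x ∘ sym))))
    Lex-loopless : ∀ u → Lex Θ Δ u u ≡ false
    Lex-loopless (a , i) = trans (Lex-same a a i (Θ-loopless i)) (Δ-loopless a)

module _ {m k : ℕ} (Θ : Graph (Fin k)) (Δ : Graph (Fin m)) where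

  blockwise-isAut : (h : Fin k → Perm (Fin m)) → (∀ i → IsAut Δ (h i)) → IsAut (Lex Θ Δ) (blockwise h)
  blockwise-isAut h h-aut (a , i) (b , x) = by-block i x (i ≟F x)
    where
    by-block : ∀ i x → Dec (i ≡ x) → Lex Θ Δ (h i ⟨$⟩ a , i) (h x ⟨$⟩ b , x) ≡ Lex Θ Δ (a , i) (b , x)
    by-block i .i (yes refl) = cong (λ d → (⌊ i ≟F i ⌋ ∧ d) ∨ Θ i i) (h-aut i a b)
    by-block i x  (no i≢x)   = trans (Lex-other Θ Δ _ _ i≢x) (sym (Lex-other Θ Δ _ _ i≢x))

onBlock-isAut : (Θ : Graph (Fin k)) (Δ : Graph (Fin m)) (j : Fin k) (x : Perm (Fin m)) → IsAut Δ x →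
  IsAut (Lex Θ Δ) (onBlock j x)
onBlock-isAut Θ Δ j x x-aut =
  blockwise-isAut Θ Δ (λ i → if ⌊ i ≟F j ⌋ then x else ↔-id _)
    (onBlock-components {P = IsAut Δ} j x x-aut (λ _ _ → refl))

rowGraph : Fin m → Graph (Vertex m k) → Graph (Fin k)
rowGraph z Γ i x = not ⌊ i ≟F x ⌋ ∧ Γ (z , i) (z , x)

rowGraph-simple : (z : Fin m) (Γ : Graph (Vertex m k)) → IsSimple Γ → IsSimple (rowGraph z Γ)
rowGraph-simple z Γ (Γ-sym , _) =
  (λ i x → cong₂ (λ b c → not b ∧ c) (⌊⌋-cong (i ≟F x) (x ≟F i) sym sym) (Γ-sym (z , i) (z , x))) ,
  (λ i → cong (λ b → not b ∧ Γ (z , i) (z , i)) (⌊⌋-true (i ≟F i) refl))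

rowGraph-other : (z : Fin m) (Γ : Graph (Vertex m k)) {i x : Fin k} → i ≢ x → rowGraph z Γ i x ≡ Γ (z , i) (z , x)
rowGraph-other z Γ {i} {x} i≢x = cong (λ b → not b ∧ Γ (z , i) (z , x)) (⌊⌋-false (i ≟F x) i≢x)

BetweenBlocksConstant : Fin m → Graph (Vertex m k) → Set
BetweenBlocksConstant z Γ = ∀ j i a b → j ≢ i → Γ (a , j) (b , i) ≡ Γ (z , j) (z , i)

≅-Lex : (z : Fin m) (Γ : Graph (Vertex m k)) → IsSimple Γ → (Δ : Graph (Fin m)) (h : Fin k → Perm (Fin m)) →
  (∀ j a b → Γ (a , j) (b , j) ≡ Δ (h j ⟨$⟩ a) (h j ⟨$⟩ b)) → BetweenBlocksConstant z Γ →
  Γ ≅ Lex (rowGraph z Γ) Δ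
≅-Lex z Γ Γ-simple Δ h within between = blockwise h , preserves
  where
  Θ = rowGraph z Γ
  preserves : ∀ u v → Lex Θ Δ (blockwise h ⟨$⟩ u) (blockwise h ⟨$⟩ v) ≡ Γ u v
  preserves (a , i) (b , x) = by-block i x (i ≟F x)
    where
    by-block : ∀ i x → Dec (i ≡ x) → Lex Θ Δ (h i ⟨$⟩ a , i) (h x ⟨$⟩ b , x) ≡ Γ (a , i) (b , x)
    by-block i .i (yes refl) =
      trans (Lex-same Θ Δ _ _ i (proj₂ (rowGraph-simple z Γ Γ-simple) i)) (sym (within i a b))
    by-block i x (no i≢x) =
      trans (Lex-other Θ Δ _ _ i≢x) (trans (rowGraph-other z Γ i≢x) (sym (between i x a b i≢x)))

-- Lexicographic products over K_m and mK₁

HasMu-Lex-uniform : ∀ c {m k} (Θ : Graph (Fin k)) → IsSimple Θ → Fin k →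
  HasMu (Lex Θ (uniform c (suc (suc m)))) 2
HasMu-Lex-uniform c {m} Θ Θ-simple j =
  (transposition u v , σ-aut , (u , λ σu≡u → u≢v (trans (sym σu≡u) (swap-at₁ u v))) , moved-transposition u≢v) ,
  λ τ _ τ≢id → moved≥2 τ τ≢id
  where
  open Transposition _≟V_
  Δ = uniform c (suc (suc m))
  u v : Vertex (suc (suc m)) _
  u = 0F , j
  v = 1F , j
  u≢v : u ≢ v
  u≢v ()
  twins : ∀ w → w ≢ u → w ≢ v → Lex Θ Δ u w ≡ Lex Θ Δ v w
  twins (δ , i) = by-block i (j ≟F i)
    where
    by-block : ∀ i → Dec (j ≡ i) → (δ , i) ≢ u → (δ , i) ≢ v → Lex Θ Δ u (δ , i) ≡ Lex Θ Δ v (δ , i)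
    by-block .j (yes refl) w≢u w≢v = begin
      Lex Θ Δ u (δ , j)  ≡⟨ Lex-same Θ Δ 0F δ j (proj₂ Θ-simple j) ⟩
      Δ 0F δ             ≡⟨ uniform-off-diagonal c (λ 0≡δ → w≢u (cong (_, j) (sym 0≡δ))) ⟩
      c                  ≡⟨ uniform-off-diagonal c (λ 1≡δ → w≢v (cong (_, j) (sym 1≡δ))) ⟨
      Δ 1F δ             ≡⟨ Lex-same Θ Δ 1F δ j (proj₂ Θ-simple j) ⟨
      Lex Θ Δ v (δ , j)  ∎
      where open ≡-Reasoning
    by-block i (no j≢i) _ _ = trans (Lex-other Θ Δ 0F δ j≢i) (sym (Lex-other Θ Δ 1F δ j≢i))
  σ-aut = transposition-isAut (Lex Θ Δ) (Lex-simple Θ Δ Θ-simple (uniform-simple c _)) u v twins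

-- Rows of withLoops _ true Γ are closed neighbourhoods, rows of withLoops _ false Γ open ones.
withLoops : {V : Set} → DecidableEquality V → Bool → Graph V → Graph V
withLoops _≟_ c Γ u w = (c ∧ ⌊ u ≟ w ⌋) ∨ Γ u w

module _ {V : Set} (_≟_ : DecidableEquality V) (c : Bool) (Γ : Graph V) where

  withLoops-other : ∀ {u w} → u ≢ w → withLoops _≟_ c Γ u w ≡ Γ u w
  withLoops-other {u} {w} u≢w =
    trans (cong (λ b → (c ∧ b) ∨ Γ u w) (⌊⌋-false (u ≟ w) u≢w)) (cong (_∨ Γ u w) (∧-zeroʳ c))

  withLoops-sym : IsSimple Γ → ∀ u w → withLoops _≟_ c Γ u w ≡ withLoops _≟_ c Γ w u
  withLoops-sym (Γ-sym , _) u w = cong₂ (λ b d → (c ∧ b) ∨ d) (⌊⌋-cong (u ≟ w) (w ≟ u) sym sym) (Γ-sym u w)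

  withLoops-isAut : (σ : Perm V) → IsAut Γ σ → IsAut (withLoops _≟_ c Γ) σ
  withLoops-isAut σ σ-aut u w =
    cong₂ (λ b d → (c ∧ b) ∨ d)
      (⌊⌋-cong ((σ ⟨$⟩ u) ≟ (σ ⟨$⟩ w)) (u ≟ w) (⟨$⟩-injective σ) (cong (σ ⟨$⟩_))) (σ-aut u w)

module Ranks where

  oneIf : Bool → ℕ
  oneIf true  = 1
  oneIf false = 0

  count : {k : ℕ} → (Fin k → Bool) → ℕ
  count {zero}  P = 0
  count {suc k} P = oneIf (P 0F) + count (P ∘ Fin.suc)

  rank : {k : ℕ} → (Fin k → Bool) → Fin k → ℕ
  rank P 0F          = 0
  rank P (Fin.suc x) = oneIf (P 0F) + rank (P ∘ Fin.suc) x

  select : {k : ℕ} → (Fin k → Bool) → ℕ → Maybe (Fin k)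
  select {zero}  P r = nothing
  select {suc k} P r with P 0F | r
  ... | true  | zero  = just 0F
  ... | true  | suc r = Maybe.map Fin.suc (select (P ∘ Fin.suc) r)
  ... | false | r     = Maybe.map Fin.suc (select (P ∘ Fin.suc) r)

  rank<count : {k : ℕ} (P : Fin k → Bool) (x : Fin k) → P x ≡ true → rank P x < count P
  rank<count P 0F          Px rewrite Px = s≤s z≤n
  rank<count P (Fin.suc x) Px = +-monoʳ-< (oneIf (P 0F)) (rank<count (P ∘ Fin.suc) x Px)

  select-rank : {k : ℕ} (P : Fin k → Bool) (x : Fin k) → P x ≡ true → select P (rank P x) ≡ just x
  select-rank P 0F Px rewrite Px = refl
  select-rank P (Fin.suc x) Px with P 0F
  ... | true  = cong (Maybe.map Fin.suc) (select-rank (P ∘ Fin.suc) x Px)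
  ... | false = cong (Maybe.map Fin.suc) (select-rank (P ∘ Fin.suc) x Px)

  select-<count : {k : ℕ} (P : Fin k → Bool) (r : ℕ) → r < count P →
    Σ (Fin k) λ x → select P r ≡ just x × P x ≡ true × rank P x ≡ r
  select-<count {suc k} P r r<count with P 0F in P0
  select-<count {suc k} P zero    _         | true = 0F , refl , P0 , refl
  select-<count {suc k} P (suc r) (s≤s r<)  | true with select-<count (P ∘ Fin.suc) r r<
  ... | x , eq , Px , rank≡ rewrite eq =
    Fin.suc x , refl , Px , trans (cong (λ b → oneIf b + rank (P ∘ Fin.suc) x) P0) (cong suc rank≡)
  select-<count {suc k} P r r<count | false with select-<count (P ∘ Fin.suc) r r<count
  ... | x , eq , Px , rank≡ rewrite eq =
    Fin.suc x , refl , Px , trans (cong (λ b → oneIf b + rank (P ∘ Fin.suc) x) P0) rank≡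

  count-cong : {k : ℕ} {P Q : Fin k → Bool} → (∀ x → P x ≡ Q x) → count P ≡ count Q
  count-cong {zero}  P≗Q = refl
  count-cong {suc k} P≗Q = cong₂ _+_ (cong oneIf (P≗Q 0F)) (count-cong (P≗Q ∘ Fin.suc))

  rank-cong : {k : ℕ} {P Q : Fin k → Bool} → (∀ x → P x ≡ Q x) → ∀ x → rank P x ≡ rank Q x
  rank-cong P≗Q 0F          = refl
  rank-cong P≗Q (Fin.suc x) = cong₂ _+_ (cong oneIf (P≗Q 0F)) (rank-cong (P≗Q ∘ Fin.suc) x)

  select-cong : {k : ℕ} {P Q : Fin k → Bool} → (∀ x → P x ≡ Q x) → ∀ r → select P r ≡ select Q r
  select-cong {zero}          P≗Q r = refl
  select-cong {suc k} {P} {Q} P≗Q r rewrite P≗Q 0F with Q 0F | r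
  ... | true  | zero  = refl
  ... | true  | suc r = cong (Maybe.map Fin.suc) (select-cong (P≗Q ∘ Fin.suc) r)
  ... | false | r     = cong (Maybe.map Fin.suc) (select-cong (P≗Q ∘ Fin.suc) r)

  holds? : {B : Set} (P : B → Bool) (x : B) → Dec (P x ≡ true)
  holds? P x = P x ≟B true

  length-filter-tabulate : {k : ℕ} {B : Set} (P : B → Bool) (g : Fin k → B) →
    length (filter (holds? P) (tabulate g)) ≡ count (P ∘ g)
  length-filter-tabulate {zero}  P g = refl
  length-filter-tabulate {suc k} P g with P (g 0F)
  ... | true  = cong suc (length-filter-tabulate P (g ∘ Fin.suc))
  ... | false = length-filter-tabulate P (g ∘ Fin.suc)

  length-filter-pairs : {B C : Set} (P : C → Bool) (xs : List B) (ys : List C) →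
    length (filter (holds? (P ∘ proj₂)) (cartesianProduct xs ys)) ≡ length xs * length (filter (holds? P) ys)
  length-filter-pairs P []       ys = refl
  length-filter-pairs P (x ∷ xs) ys = begin
    length (filter Q (map (x ,_) ys ++ cartesianProduct xs ys))
      ≡⟨ cong length (filter-++ Q (map (x ,_) ys) _) ⟩
    length (filter Q (map (x ,_) ys) ++ filter Q (cartesianProduct xs ys))
      ≡⟨ length-++ (filter Q (map (x ,_) ys)) ⟩
    length (filter Q (map (x ,_) ys)) + length (filter Q (cartesianProduct xs ys))
      ≡⟨ cong₂ _+_ (row ys) (length-filter-pairs P xs ys) ⟩
    length (filter (holds? P) ys) + length xs * length (filter (holds? P) ys)
      ∎
    where
    open ≡-Reasoning
    Q = holds? (P ∘ proj₂)
    row : ∀ ys → length (filter Q (map (x ,_) ys)) ≡ length (filter (holds? P) ys)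
    row []       = refl
    row (y ∷ ys) with P y
    ... | true  = cong suc (row ys)
    ... | false = row ys

  count-blocks : (m : ℕ) {k : ℕ} (P : Fin k → Bool) →
    length (filter (holds? (P ∘ proj₂)) (allV m k)) ≡ m * count P
  count-blocks m P = trans (length-filter-pairs P (allFin m) (allFin _))
    (cong₂ _*_ (length-tabulate {n = m} id) (length-filter-tabulate P id))

module LexUniform {m k : ℕ} (c : Bool) (Θ : Graph (Fin k)) (Θ-simple : IsSimple Θ) (z : Fin m) where
  open Ranks

  Λ : Graph (Vertex m k)
  Λ = Lex Θ (uniform c m)

  N : Graph (Fin k)
  N = withLoops _≟F_ c Θ

  withLoops-Λ : ∀ u w → withLoops _≟V_ c Λ u w ≡ N (proj₂ u) (proj₂ w)
  withLoops-Λ (a , i) (b , x) = by-cases c i x (i ≟F x) (a ≟F b)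
    where
    by-cases : ∀ c i x → Dec (i ≡ x) → Dec (a ≡ b) →
      withLoops _≟V_ c (Lex Θ (uniform c m)) (a , i) (b , x) ≡ withLoops _≟F_ c Θ i x
    by-cases false i x _ _ = cong (λ b → false ∨ (b ∨ Θ i x)) (∧-zeroʳ ⌊ i ≟F x ⌋)
    by-cases true i x (no i≢x) _
      rewrite ⌊⌋-false ((a , i) ≟V (b , x)) (i≢x ∘ cong proj₂) | ⌊⌋-false (i ≟F x) i≢x = refl
    by-cases true i .i (yes refl) (yes refl) rewrite ⌊⌋-true ((a , i) ≟V (a , i)) refl | ⌊⌋-true (i ≟F i) refl = refl
    by-cases true i .i (yes refl) (no a≢b)
      rewrite ⌊⌋-false ((a , i) ≟V (b , i)) (a≢b ∘ cong proj₁) | ⌊⌋-true (i ≟F i) refl | ⌊⌋-false (a ≟F b) a≢b = refl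

  SameN : Fin k → Fin k → Set
  SameN i x = ∀ y → N i y ≡ N x y

  sameN? : Fin k → Fin k → Bool
  sameN? i x = ⌊ all? (λ y → N i y ≟B N x y) ⌋

  sameN?-sound : ∀ {i x} → sameN? i x ≡ true → SameN i x
  sameN?-sound {i} {x} = ⌊⌋-sound (all? (λ y → N i y ≟B N x y))

  sameN?-complete : ∀ {i x} → SameN i x → sameN? i x ≡ true
  sameN?-complete {i} {x} = ⌊⌋-true (all? (λ y → N i y ≟B N x y))

  sameN?-cong : ∀ {i i′} → SameN i i′ → ∀ x → sameN? i x ≡ sameN? i′ x
  sameN?-cong {i} {i′} i~i′ x = ⌊⌋-cong (all? (λ y → N i y ≟B N x y)) (all? (λ y → N i′ y ≟B N x y))
    (λ i~x y → trans (sym (i~i′ y)) (i~x y)) (λ i′~x y → trans (i~i′ y) (i′~x y))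

  twins-transposition : ∀ {a b} → SameN a b → IsAut Θ (Transposition.transposition _≟F_ a b)
  twins-transposition {a} {b} a~b = Transposition.transposition-isAut _≟F_ Θ Θ-simple a b
    λ w w≢a w≢b → trans (sym (withLoops-other _≟F_ c Θ (w≢a ∘ sym)))
                    (trans (a~b w) (withLoops-other _≟F_ c Θ (w≢b ∘ sym)))

  blockOf : Perm (Vertex m k) → Fin k → Fin k
  blockOf σ i = proj₂ (σ ⟨$⟩ (z , i))

  module _ (σ : Perm (Vertex m k)) (σ-aut : IsAut Λ σ) where

    N-blocks-preserved : ∀ u w → N (proj₂ (σ ⟨$⟩ u)) (proj₂ (σ ⟨$⟩ w)) ≡ N (proj₂ u) (proj₂ w)
    N-blocks-preserved u w = begin
      N (proj₂ (σ ⟨$⟩ u)) (proj₂ (σ ⟨$⟩ w))   ≡⟨ withLoops-Λ (σ ⟨$⟩ u) (σ ⟨$⟩ w) ⟨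
      withLoops _≟V_ c Λ (σ ⟨$⟩ u) (σ ⟨$⟩ w)  ≡⟨ withLoops-isAut _≟V_ c Λ σ σ-aut u w ⟩
      withLoops _≟V_ c Λ u w                  ≡⟨ withLoops-Λ u w ⟩
      N (proj₂ u) (proj₂ w)                   ∎
      where open ≡-Reasoning

    N-pullback : ∀ u y → N (proj₂ (σ ⟨$⟩ u)) y ≡ N (proj₂ u) (blockOf (↔-sym σ) y)
    N-pullback u y = trans (cong (λ w → N (proj₂ (σ ⟨$⟩ u)) (proj₂ w)) (sym (⟨$⟩-⟨$⟩⁻¹ σ (z , y))))
                           (N-blocks-preserved u (σ ⟨$⟩⁻¹ (z , y)))

    SameN-image : ∀ u v → SameN (proj₂ u) (proj₂ v) → SameN (proj₂ (σ ⟨$⟩ u)) (proj₂ (σ ⟨$⟩ v))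
    SameN-image u v u~v y = trans (N-pullback u y) (trans (u~v _) (sym (N-pullback v y)))

    classSize-≤ : ∀ i → m * count (sameN? i) ≤ m * count (sameN? (blockOf σ i))
    classSize-≤ i = subst₂ _≤_ (trans (length-map (σ ⟨$⟩_) (class i)) (count-blocks m (sameN? i)))
                               (count-blocks m (sameN? (blockOf σ i)))
      (Unique-length-≤ (map⁺ (⟨$⟩-injective σ) (filter⁺ (holds? (sameN? i ∘ proj₂)) allV-unique)) image⊆)
      where
      class : Fin k → List (Vertex m k)
      class i = filter (holds? (sameN? i ∘ proj₂)) (allV m k)
      image⊆ : ∀ {w} → w ∈ map (σ ⟨$⟩_) (class i) → w ∈ class (blockOf σ i)
      image⊆ w∈ with ∈-map⁻ (σ ⟨$⟩_) w∈
      ... | v , v∈ , refl = ∈-filter⁺ (holds? (sameN? (blockOf σ i) ∘ proj₂)) (∈-allV _)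
              (sameN?-complete (SameN-image (z , i) v
                (sameN?-sound (proj₂ (∈-filter⁻ (holds? (sameN? i ∘ proj₂)) {xs = allV m k} v∈)))))

  blockOf-inverse : (σ : Perm (Vertex m k)) → IsAut Λ σ → ∀ y → SameN (blockOf σ (blockOf (↔-sym σ) y)) y
  blockOf-inverse σ σ-aut y x = trans (N-pullback σ σ-aut (z , blockOf (↔-sym σ) y) x)
                                      (N-blocks-preserved (↔-sym σ) (IsAut-⁻¹ Λ σ σ-aut) (z , y) (z , x))

  module _ (σ : Perm (Vertex m k)) (σ-aut : IsAut Λ σ) where
    private
      σ⁻¹ : Perm (Vertex m k)
      σ⁻¹ = ↔-sym σ
      σ⁻¹-aut : IsAut Λ σ⁻¹
      σ⁻¹-aut = IsAut-⁻¹ Λ σ σ-aut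

    classSize-≡ : ∀ i → count (sameN? i) ≡ count (sameN? (blockOf σ i))
    classSize-≡ i = ≤-antisym (*-cancelˡ-≤ m {{nonZeroIndex z}} (classSize-≤ σ σ-aut i))
      (*-cancelˡ-≤ m {{nonZeroIndex z}} (subst (m * count (sameN? (blockOf σ i)) ≤_)
        (cong (m *_) (count-cong (sameN?-cong (blockOf-inverse σ⁻¹ σ⁻¹-aut i))))
        (classSize-≤ σ⁻¹ σ⁻¹-aut (blockOf σ i))))

  -- i goes to the element of the class of blockOf σ i whose rank there is the rank of i in its
  -- own class; classSize-≡ guarantees that such an element exists.
  matching : Perm (Vertex m k) → Fin k → Fin k
  matching σ i = Maybe.fromMaybe i (select (sameN? (blockOf σ i)) (rank (sameN? i) i))

  module _ (σ : Perm (Vertex m k)) (σ-aut : IsAut Λ σ) where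
    private
      σ⁻¹ : Perm (Vertex m k)
      σ⁻¹ = ↔-sym σ
      σ⁻¹-aut : IsAut Λ σ⁻¹
      σ⁻¹-aut = IsAut-⁻¹ Λ σ σ-aut

    matching-spec : ∀ i → SameN (blockOf σ i) (matching σ i)
                        × rank (sameN? (blockOf σ i)) (matching σ i) ≡ rank (sameN? i) i
    matching-spec i with select-<count (sameN? (blockOf σ i)) (rank (sameN? i) i)
                          (subst (rank (sameN? i) i <_) (classSize-≡ σ σ-aut i)
                            (rank<count (sameN? i) i (sameN?-complete λ _ → refl)))
    ... | x , selected , fi~x , rank≡ rewrite selected = sameN?-sound fi~x , rank≡

    matching-inverse : ∀ i → matching σ⁻¹ (matching σ i) ≡ i
    matching-inverse i = cong (Maybe.fromMaybe y) (begin
      select (sameN? (blockOf σ⁻¹ y)) (rank (sameN? y) y)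
        ≡⟨ select-cong (sameN?-cong (λ x → trans (SameN-image σ⁻¹ σ⁻¹-aut (z , y) (z , blockOf σ i) y~fi x)
                                                  (blockOf-inverse σ⁻¹ σ⁻¹-aut i x))) _ ⟩
      select (sameN? i) (rank (sameN? y) y)
        ≡⟨ cong (select (sameN? i)) (trans (rank-cong (sameN?-cong y~fi) y) (proj₂ (matching-spec i))) ⟩
      select (sameN? i) (rank (sameN? i) i)
        ≡⟨ select-rank (sameN? i) i (sameN?-complete λ _ → refl) ⟩
      just i ∎)
      where
      open ≡-Reasoning
      y = matching σ i
      y~fi : SameN y (blockOf σ i)
      y~fi x = sym (proj₁ (matching-spec i) x)

    matching-isAut : ∀ i x → Θ (matching σ i) (matching σ x) ≡ Θ i x
    matching-isAut i x with i ≟F x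
    ... | yes refl = trans (proj₂ Θ-simple _) (sym (proj₂ Θ-simple i))
    ... | no i≢x = begin
      Θ (matching σ i) (matching σ x)    ≡⟨ withLoops-other _≟F_ c Θ images-differ ⟨
      N (matching σ i) (matching σ x)    ≡⟨ proj₁ (matching-spec i) _ ⟨
      N (blockOf σ i) (matching σ x)     ≡⟨ withLoops-sym _≟F_ c Θ Θ-simple _ _ ⟩
      N (matching σ x) (blockOf σ i)     ≡⟨ proj₁ (matching-spec x) _ ⟨
      N (blockOf σ x) (blockOf σ i)      ≡⟨ N-blocks-preserved σ σ-aut (z , x) (z , i) ⟩
      N x i                              ≡⟨ withLoops-sym _≟F_ c Θ Θ-simple x i ⟩
      N i x                              ≡⟨ withLoops-other _≟F_ c Θ i≢x ⟩
      Θ i x                              ∎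
      where
      open ≡-Reasoning
      images-differ : matching σ i ≢ matching σ x
      images-differ eq = i≢x (trans (sym (matching-inverse i)) (trans (cong (matching σ⁻¹) eq) (matching-inverse x)))

  vertexTransitive-factor : VertexTransitive Λ → VertexTransitive Θ
  vertexTransitive-factor Λ-vt j j′ with Λ-vt (z , j) (z , j′)
  ... | σ , σ-aut , σj≡j′ =
    transposition a j′ ↔-∘ τ ,
    IsAut-∘ Θ (transposition a j′) τ (twins-transposition a~j′) (matching-isAut σ σ-aut) ,
    swap-at₁ a j′
    where
    open Transposition _≟F_
    τ : Perm (Fin k)
    τ = mk↔ₛ′ (matching σ) (matching (↔-sym σ))
          (matching-inverse (↔-sym σ) (IsAut-⁻¹ Λ σ σ-aut)) (matching-inverse σ σ-aut)
    a : Fin k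
    a = matching σ j
    a~j′ : SameN a j′
    a~j′ y = trans (sym (proj₁ (matching-spec σ σ-aut j) y)) (cong (λ v → N (proj₂ v) y) σj≡j′)

-- Lexicographic products over C₅

negate : Perm (Fin 5)
negate = mk↔ₛ′ neg neg neg-involutive neg-involutive
  where
  neg : Fin 5 → Fin 5
  neg 0F = 0F
  neg 1F = 4F
  neg 2F = 3F
  neg 3F = 2F
  neg 4F = 1F
  neg-involutive : ∀ a → neg (neg a) ≡ a
  neg-involutive 0F = refl
  neg-involutive 1F = refl
  neg-involutive 2F = refl
  neg-involutive 3F = refl
  neg-involutive 4F = refl

-- Finite facts are decided by exhaustive search; abstract keeps the search from being unfolded
-- wherever the facts are used.
abstract
  C5-negate : IsAut C5 negate
  C5-negate = from-yes (all? λ a → all? λ b → C5 (negate ⟨$⟩ a) (negate ⟨$⟩ b) ≟B C5 a b)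

  C5-pairsSeparated : PairsSeparated C5
  C5-pairsSeparated = from-yes (all? λ u → all? λ v → ¬? (u ≟F v) →-dec
    any? λ x → ¬? (x ≟F u) ×-dec ¬? (x ≟F v) ×-dec ¬? (C5 x u ≟B C5 x v))

  C5-triplesSeparated : TriplesSeparated C5
  C5-triplesSeparated = from-yes (all? λ u → all? λ v → all? λ w →
    ¬? (u ≟F v) →-dec ¬? (u ≟F w) →-dec ¬? (v ≟F w) →-dec
    any? λ x → ¬? (x ≟F u) ×-dec ¬? (x ≟F v) ×-dec ¬? (x ≟F w) ×-dec
      (¬? (C5 x u ≟B C5 x v) ⊎-dec ¬? (C5 x v ≟B C5 x w)))

  C5-at-most-two-separators : ∀ a b c₁ c₂ c₃ → a ≢ b → c₁ ≢ c₂ → c₁ ≢ c₃ → c₂ ≢ c₃ →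
    Separator C5 a b c₁ → Separator C5 a b c₂ → ¬ Separator C5 a b c₃
  C5-at-most-two-separators = from-yes (all? λ a → all? λ b → all? λ c₁ → all? λ c₂ → all? λ c₃ →
    ¬? (a ≟F b) →-dec ¬? (c₁ ≟F c₂) →-dec ¬? (c₁ ≟F c₃) →-dec ¬? (c₂ ≟F c₃) →-dec
    separator? a b c₁ →-dec separator? a b c₂ →-dec ¬? (separator? a b c₃))
    where
    separator? : ∀ a b c → Dec (Separator C5 a b c)
    separator? a b c = ¬? (c ≟F a) ×-dec ¬? (c ≟F b) ×-dec ¬? (C5 c a ≟B C5 c b)

  C5-two-disagreeing : ∀ a t → Σ (Fin 5) λ d₁ → Σ (Fin 5) λ d₂ →
    d₁ ≢ a × d₂ ≢ a × d₁ ≢ d₂ × C5 d₁ a ≢ t × C5 d₂ a ≢ t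
  C5-two-disagreeing = from-yes (all? λ a → ∀-Bool? λ t → any? λ d₁ → any? λ d₂ →
    ¬? (d₁ ≟F a) ×-dec ¬? (d₂ ≟F a) ×-dec ¬? (d₁ ≟F d₂) ×-dec ¬? (C5 d₁ a ≟B t) ×-dec ¬? (C5 d₂ a ≟B t))

  C5-disagreeing : ∀ a e t → Σ (Fin 5) λ d → d ≢ a × d ≢ e × C5 d a ≢ t
  C5-disagreeing = from-yes (all? λ a → all? λ e → ∀-Bool? λ t →
    any? λ d → ¬? (d ≟F a) ×-dec ¬? (d ≟F e) ×-dec ¬? (C5 d a ≟B t))

moved-negate-block : (j : Fin k) → moved (onBlock j negate) ≡ 4
moved-negate-block j = moved-≡ σ distinct moves only
  where
  σ = onBlock j negate
  reflected : List (Vertex 5 _)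
  reflected = (1F , j) ∷ (2F , j) ∷ (3F , j) ∷ (4F , j) ∷ []
  distinct : Unique reflected
  distinct = ((λ ()) ∷ (λ ()) ∷ (λ ()) ∷ []) ∷ ((λ ()) ∷ (λ ()) ∷ []) ∷ ((λ ()) ∷ []) ∷ [] ∷ []
  moves : ∀ {x} → x ∈ reflected → Moves σ x
  moves (here refl)                         eq with () ← trans (sym (onBlock-at j negate 1F)) eq
  moves (there (here refl))                 eq with () ← trans (sym (onBlock-at j negate 2F)) eq
  moves (there (there (here refl)))         eq with () ← trans (sym (onBlock-at j negate 3F)) eq
  moves (there (there (there (here refl)))) eq with () ← trans (sym (onBlock-at j negate 4F)) eq
  only : ∀ x → Moves σ x → x ∈ reflected
  only (a , i) = by-block i (i ≟F j) a
    where
    by-block : ∀ i → Dec (i ≡ j) → ∀ a → Moves σ (a , i) → (a , i) ∈ reflected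
    by-block i  (no i≢j)   a  moves = ⊥-elim (moves (onBlock-off j negate a i≢j))
    by-block .j (yes refl) 0F moves = ⊥-elim (moves (onBlock-at j negate 0F))
    by-block .j (yes refl) 1F _     = here refl
    by-block .j (yes refl) 2F _     = there (here refl)
    by-block .j (yes refl) 3F _     = there (there (here refl))
    by-block .j (yes refl) 4F _     = there (there (there (here refl)))

record ThreeSeparators (Γ : Graph A) (u v : A) : Set where
  field
    w₁ w₂ w₃ : A
    separates₁ : Separator Γ u v w₁
    separates₂ : Separator Γ u v w₂
    separates₃ : Separator Γ u v w₃
    w₁≢w₂ : w₁ ≢ w₂
    w₁≢w₃ : w₁ ≢ w₃
    w₂≢w₃ : w₂ ≢ w₃

ThreeSeparators-pullback : (Γ : Graph A) (σ : Perm A) → IsAut Γ σ → ∀ {u v} →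
  ThreeSeparators Γ (σ ⟨$⟩ u) (σ ⟨$⟩ v) → ThreeSeparators Γ u v
ThreeSeparators-pullback Γ σ σ-aut {u} {v} three = record
  { w₁ = σ ⟨$⟩⁻¹ w₁ ; w₂ = σ ⟨$⟩⁻¹ w₂ ; w₃ = σ ⟨$⟩⁻¹ w₃
  ; separates₁ = pull separates₁ ; separates₂ = pull separates₂ ; separates₃ = pull separates₃
  ; w₁≢w₂ = w₁≢w₂ ∘ ⟨$⟩⁻¹-injective σ
  ; w₁≢w₃ = w₁≢w₃ ∘ ⟨$⟩⁻¹-injective σ
  ; w₂≢w₃ = w₂≢w₃ ∘ ⟨$⟩⁻¹-injective σ }
  where
  open ThreeSeparators three
  sees : ∀ w x → Γ w (σ ⟨$⟩ x) ≡ Γ (σ ⟨$⟩⁻¹ w) x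
  sees w x = trans (cong (λ y → Γ y (σ ⟨$⟩ x)) (sym (⟨$⟩-⟨$⟩⁻¹ σ w))) (σ-aut (σ ⟨$⟩⁻¹ w) x)
  pull : ∀ {w} → Separator Γ (σ ⟨$⟩ u) (σ ⟨$⟩ v) w → Separator Γ u v (σ ⟨$⟩⁻¹ w)
  pull {w} (w≢σu , w≢σv , separates) =
    (λ eq → w≢σu (trans (sym (⟨$⟩-⟨$⟩⁻¹ σ w)) (cong (σ ⟨$⟩_) eq))) ,
    (λ eq → w≢σv (trans (sym (⟨$⟩-⟨$⟩⁻¹ σ w)) (cong (σ ⟨$⟩_) eq))) ,
    λ eq → separates (trans (sees w u) (trans eq (sym (sees w v))))

module LexC5 {k : ℕ} (Θ : Graph (Fin k)) (Θ-simple : IsSimple Θ) where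

  Λ : Graph (Vertex 5 k)
  Λ = Lex Θ C5

  Λ-same : ∀ a b i → Λ (a , i) (b , i) ≡ C5 a b
  Λ-same a b i = Lex-same Θ C5 a b i (proj₂ Θ-simple i)

  Λ-other : ∀ a b {i x} → i ≢ x → Λ (a , i) (b , x) ≡ Θ i x
  Λ-other = Lex-other Θ C5

  separate-blocks : ∀ a b {i x} → i ≢ x → (r : Vertex 5 k) →
    Σ (Vertex 5 k) λ w → w ≢ (a , i) × w ≢ (b , x) × w ≢ r × Separates Λ w (a , i) (b , x)
  separate-blocks a b {i} {x} i≢x (c , _) with C5-disagreeing a c (Θ i x)
  ... | d , d≢a , d≢c , C5da≢Θix =
    (d , i) , d≢a ∘ cong proj₁ , i≢x ∘ cong proj₂ , d≢c ∘ cong proj₁ ,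
    λ eq → C5da≢Θix (trans (sym (Λ-same d a i)) (trans eq (Λ-other d b i≢x)))

  pairsSeparated : PairsSeparated Λ
  pairsSeparated (a , i) (b , x) = by-block i x (i ≟F x)
    where
    by-block : ∀ i x → Dec (i ≡ x) → (a , i) ≢ (b , x) →
      Σ (Vertex 5 k) λ w → w ≢ (a , i) × w ≢ (b , x) × Separates Λ w (a , i) (b , x)
    by-block i .i (yes refl) u≢v with C5-pairsSeparated a b (u≢v ∘ cong (_, i))
    ... | c , c≢a , c≢b , separates =
      (c , i) , c≢a ∘ cong proj₁ , c≢b ∘ cong proj₁ ,
      λ eq → separates (trans (sym (Λ-same c a i)) (trans eq (Λ-same c b i)))
    by-block i x (no i≢x) _ with separate-blocks a b i≢x (a , i)
    ... | w , w≢u , w≢v , _ , separates = w , w≢u , w≢v , separates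

  triplesSeparated : TriplesSeparated Λ
  triplesSeparated (a , i) (b , x) (c , y) = by-blocks i x y (i ≟F x) (x ≟F y)
    where
    by-blocks : ∀ i x y → Dec (i ≡ x) → Dec (x ≡ y) → (a , i) ≢ (b , x) → (a , i) ≢ (c , y) → (b , x) ≢ (c , y) →
      Σ (Vertex 5 k) λ w → w ≢ (a , i) × w ≢ (b , x) × w ≢ (c , y) ×
        (Separates Λ w (a , i) (b , x) ⊎ Separates Λ w (b , x) (c , y))
    by-blocks i x y (no i≢x) _ _ _ _ with separate-blocks a b i≢x (c , y)
    ... | w , w≢u , w≢v , w≢r , separates = w , w≢u , w≢v , w≢r , inj₁ separates
    by-blocks i .i y (yes refl) (no x≢y) _ _ _ with separate-blocks b c x≢y (a , i)
    ... | w , w≢v , w≢r , w≢u , separates = w , w≢u , w≢v , w≢r , inj₂ separates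
    by-blocks i .i .i (yes refl) (yes refl) u≢v u≢w v≢w
      with C5-triplesSeparated a b c (u≢v ∘ cong (_, i)) (u≢w ∘ cong (_, i)) (v≢w ∘ cong (_, i))
    ... | d , d≢a , d≢b , d≢c , separates =
      (d , i) , d≢a ∘ cong proj₁ , d≢b ∘ cong proj₁ , d≢c ∘ cong proj₁ ,
      Data.Sum.map (λ sep eq → sep (trans (sym (Λ-same d a i)) (trans eq (Λ-same d b i))))
                   (λ sep eq → sep (trans (sym (Λ-same d b i)) (trans eq (Λ-same d c i)))) separates

  HasMu-Lex-C5 : Fin k → HasMu Λ 4
  HasMu-Lex-C5 j =
    (onBlock j negate , onBlock-isAut Θ C5 j negate C5-negate ,
       ((1F , j) , λ eq → case trans (sym (onBlock-at j negate 1F)) eq of λ ()) , moved-negate-block j) ,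
    moved≥4 Λ pairsSeparated triplesSeparated

  sameBlock-fewSeparators : ∀ a b i → a ≢ b → ¬ ThreeSeparators Λ (a , i) (b , i)
  sameBlock-fewSeparators a b i a≢b three =
    C5-at-most-two-separators a b (col w₁) (col w₂) (col w₃) a≢b
      (λ eq → w₁≢w₂ (≡-in-block w₁ w₂ separates₁ separates₂ eq))
      (λ eq → w₁≢w₃ (≡-in-block w₁ w₃ separates₁ separates₃ eq))
      (λ eq → w₂≢w₃ (≡-in-block w₂ w₃ separates₂ separates₃ eq))
      (in-C5 w₁ separates₁) (in-C5 w₂ separates₂) (in-C5 w₃ separates₃)
    where
    open ThreeSeparators three
    col : Vertex 5 k → Fin 5
    col = proj₁
    in-block : ∀ w → Separator Λ (a , i) (b , i) w → proj₂ w ≡ i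
    in-block (c , x) (_ , _ , separates) = decidable-stable (x ≟F i)
      λ x≢i → separates (trans (Λ-other c a x≢i) (sym (Λ-other c b x≢i)))
    ≡-in-block : ∀ w w′ → Separator Λ (a , i) (b , i) w → Separator Λ (a , i) (b , i) w′ → col w ≡ col w′ → w ≡ w′
    ≡-in-block (c , x) (c′ , x′) s s′ refl = cong (c ,_) (trans (in-block _ s) (sym (in-block _ s′)))
    in-C5 : ∀ w → Separator Λ (a , i) (b , i) w → Separator C5 a b (col w)
    in-C5 (c , x) s@(w≢u , w≢v , separates) with in-block (c , x) s
    ... | refl = w≢u ∘ cong (_, i) , w≢v ∘ cong (_, i) ,
                 λ eq → separates (trans (Λ-same c a i) (trans eq (sym (Λ-same c b i))))

  otherBlocks-manySeparators : ∀ a b {i x} → i ≢ x → ThreeSeparators Λ (a , i) (b , x)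
  otherBlocks-manySeparators a b {i} {x} i≢x
    with C5-two-disagreeing a (Θ i x) | C5-disagreeing b b (Θ i x)
  ... | d₁ , d₂ , d₁≢a , d₂≢a , d₁≢d₂ , C5d₁a≢t , C5d₂a≢t | e , e≢b , _ , C5eb≢t = record
    { w₁ = d₁ , i ; w₂ = d₂ , i ; w₃ = e , x
    ; separates₁ = d₁≢a ∘ cong proj₁ , i≢x ∘ cong proj₂ ,
                   λ eq → C5d₁a≢t (trans (sym (Λ-same d₁ a i)) (trans eq (Λ-other d₁ b i≢x)))
    ; separates₂ = d₂≢a ∘ cong proj₁ , i≢x ∘ cong proj₂ ,
                   λ eq → C5d₂a≢t (trans (sym (Λ-same d₂ a i)) (trans eq (Λ-other d₂ b i≢x)))
    ; separates₃ = i≢x ∘ sym ∘ cong proj₂ , e≢b ∘ cong proj₁ ,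
                   λ eq → C5eb≢t (trans (sym (Λ-same e b x)) (trans (sym eq)
                            (trans (Λ-other e a (i≢x ∘ sym)) (proj₁ Θ-simple x i))))
    ; w₁≢w₂ = d₁≢d₂ ∘ cong proj₁
    ; w₁≢w₃ = i≢x ∘ cong proj₂
    ; w₂≢w₃ = i≢x ∘ cong proj₂ }

  block-preserved : (σ : Perm (Vertex 5 k)) → IsAut Λ σ → ∀ a b i → proj₂ (σ ⟨$⟩ (a , i)) ≡ proj₂ (σ ⟨$⟩ (b , i))
  block-preserved σ σ-aut a b i with a ≟F b | proj₂ (σ ⟨$⟩ (a , i)) ≟F proj₂ (σ ⟨$⟩ (b , i))
  ... | yes refl | _            = refl
  ... | no _     | yes same     = same
  ... | no a≢b   | no different = ⊥-elim (sameBlock-fewSeparators a b i a≢b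
        (ThreeSeparators-pullback Λ σ σ-aut (otherBlocks-manySeparators _ _ different)))

  blockMap : Perm (Vertex 5 k) → Fin k → Fin k
  blockMap σ i = proj₂ (σ ⟨$⟩ (0F , i))

  blockMap-inverse : (σ : Perm (Vertex 5 k)) (σ-aut : IsAut Λ σ) →
    ∀ i → blockMap (↔-sym σ) (blockMap σ i) ≡ i
  blockMap-inverse σ σ-aut i =
    trans (block-preserved (↔-sym σ) (IsAut-⁻¹ Λ σ σ-aut) 0F (proj₁ (σ ⟨$⟩ (0F , i))) (blockMap σ i))
          (cong proj₂ (⟨$⟩⁻¹-⟨$⟩ σ (0F , i)))

  blockMap-isAut : (σ : Perm (Vertex 5 k)) (σ-aut : IsAut Λ σ) →
    ∀ i x → Θ (blockMap σ i) (blockMap σ x) ≡ Θ i x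
  blockMap-isAut σ σ-aut i x with i ≟F x
  ... | yes refl = trans (proj₂ Θ-simple _) (sym (proj₂ Θ-simple i))
  ... | no i≢x   = begin
    Θ (blockMap σ i) (blockMap σ x)
      ≡⟨ Λ-other (proj₁ (σ ⟨$⟩ (0F , i))) (proj₁ (σ ⟨$⟩ (0F , x))) blocks-differ ⟨
    Λ (σ ⟨$⟩ (0F , i)) (σ ⟨$⟩ (0F , x))       ≡⟨ σ-aut (0F , i) (0F , x) ⟩
    Λ (0F , i) (0F , x)                       ≡⟨ Λ-other 0F 0F i≢x ⟩
    Θ i x                                     ∎
    where
    open ≡-Reasoning
    blocks-differ : blockMap σ i ≢ blockMap σ x
    blocks-differ eq = i≢x (trans (sym (blockMap-inverse σ σ-aut i))
                             (trans (cong (blockMap (↔-sym σ)) eq) (blockMap-inverse σ σ-aut x)))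

  vertexTransitive-factor : VertexTransitive Λ → VertexTransitive Θ
  vertexTransitive-factor Λ-vt i x with Λ-vt (0F , i) (0F , x)
  ... | σ , σ-aut , σi≡x =
    mk↔ₛ′ (blockMap σ) (blockMap (↔-sym σ))
      (blockMap-inverse (↔-sym σ) (IsAut-⁻¹ Λ σ σ-aut)) (blockMap-inverse σ σ-aut) ,
    blockMap-isAut σ σ-aut , cong proj₂ σi≡x

-- Graphs invariant under the base group

BlockSymmetry : Graph (Vertex m k) → (Fin m → Fin m) → Set
BlockSymmetry Γ f = (∀ j a b → Γ (f a , j) (f b , j) ≡ Γ (a , j) (b , j))
                  × (∀ j i a b → i ≢ j → Γ (f a , j) (b , i) ≡ Γ (a , j) (b , i))

BlockSymmetry-∘ : (Γ : Graph (Vertex m k)) {f g : Fin m → Fin m} →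
  BlockSymmetry Γ f → BlockSymmetry Γ g → BlockSymmetry Γ (g ∘ f)
BlockSymmetry-∘ Γ {f} {g} (f-within , f-between) (g-within , g-between) =
  (λ j a b → trans (g-within j (f a) (f b)) (f-within j a b)) ,
  (λ j i a b i≢j → trans (g-between j i (f a) b i≢j) (f-between j i a b i≢j))

base-BlockSymmetry : (X : Perm (Fin m) → Set) → X (↔-id _) → (Γ : Graph (Vertex m k)) →
  (∀ g → InBase X g → IsAut Γ g) → ∀ x → X x → BlockSymmetry Γ (x ⟨$⟩_)
base-BlockSymmetry X id∈X Γ base⊆Aut x x∈X = within , between
  where
  lifted : ∀ j → IsAut Γ (onBlock j x)
  lifted j = base⊆Aut (onBlock j x)
    ((λ i → if ⌊ i ≟F j ⌋ then x else ↔-id _) , onBlock-components {P = X} j x x∈X id∈X , λ _ _ → refl)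
  within : ∀ j a b → Γ (x ⟨$⟩ a , j) (x ⟨$⟩ b , j) ≡ Γ (a , j) (b , j)
  within j a b = trans (sym (cong₂ Γ (onBlock-at j x a) (onBlock-at j x b))) (lifted j (a , j) (b , j))
  between : ∀ j i a b → i ≢ j → Γ (x ⟨$⟩ a , j) (b , i) ≡ Γ (a , j) (b , i)
  between j i a b i≢j = trans (sym (cong₂ Γ (onBlock-at j x a) (onBlock-off j x b i≢j))) (lifted j (a , j) (b , i))

SymmetriesTransitive : Graph (Vertex m k) → Fin m → Set
SymmetriesTransitive {m} Γ z = ∀ a → Σ (Fin m → Fin m) λ f → BlockSymmetry Γ f × f a ≡ z

SymmetriesTwoTransitive : Graph (Vertex m k) → Fin m → Fin m → Set
SymmetriesTwoTransitive {m} Γ z o = ∀ a b → a ≢ b → Σ (Fin m → Fin m) λ f → BlockSymmetry Γ f × f a ≡ z × f b ≡ o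

betweenBlocksConstant : (Γ : Graph (Vertex m k)) → IsSimple Γ → (z : Fin m) →
  SymmetriesTransitive Γ z → BetweenBlocksConstant z Γ
betweenBlocksConstant Γ (Γ-sym , _) z transitive j i a b j≢i with transitive a | transitive b
... | f , (_ , f-between) , fa≡z | g , (_ , g-between) , gb≡z = begin
  Γ (a , j) (b , i)   ≡⟨ f-between j i a b (j≢i ∘ sym) ⟨
  Γ (f a , j) (b , i) ≡⟨ cong (λ x → Γ (x , j) (b , i)) fa≡z ⟩
  Γ (z , j) (b , i)   ≡⟨ Γ-sym _ _ ⟩
  Γ (b , i) (z , j)   ≡⟨ g-between i j b z j≢i ⟨
  Γ (g b , i) (z , j) ≡⟨ cong (λ x → Γ (x , i) (z , j)) gb≡z ⟩
  Γ (z , i) (z , j)   ≡⟨ Γ-sym _ _ ⟩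
  Γ (z , j) (z , i)   ∎
  where open ≡-Reasoning

withinBlocksConstant : (Γ : Graph (Vertex m k)) (z o : Fin m) → SymmetriesTwoTransitive Γ z o →
  ∀ j a b → a ≢ b → Γ (a , j) (b , j) ≡ Γ (z , j) (o , j)
withinBlocksConstant Γ z o twoTransitive j a b a≢b with twoTransitive a b a≢b
... | f , (f-within , _) , fa≡z , fb≡o =
  trans (sym (f-within j a b)) (cong₂ (λ x y → Γ (x , j) (y , j)) fa≡z fb≡o)

act : {L : Set} → (L → Perm (Fin m)) → List L → Fin m → Fin m
act gen []      a = a
act gen (l ∷ w) a = act gen w (gen l ⟨$⟩ a)

act-++ : {L : Set} (gen : L → Perm (Fin m)) (w w′ : List L) (a : Fin m) →
  act gen (w ++ w′) a ≡ act gen w′ (act gen w a)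
act-++ gen []      w′ a = refl
act-++ gen (l ∷ w) w′ a = act-++ gen w w′ (gen l ⟨$⟩ a)

act-injective : {L : Set} (gen : L → Perm (Fin m)) (w : List L) {a b : Fin m} → act gen w a ≡ act gen w b → a ≡ b
act-injective gen []      eq = eq
act-injective gen (l ∷ w) eq = ⟨$⟩-injective (gen l) (act-injective gen w eq)

record WordCertificate (X : Perm (Fin m) → Set) (z o : Fin m) : Set₁ where
  field
    Letter         : Set
    gen            : Letter → Perm (Fin m)
    gen∈X          : ∀ l → X (gen l)
    toBase         : Fin m → List Letter
    toBase-sends   : ∀ a → act gen (toBase a) a ≡ z
    toSecond       : Fin m → List Letter
    toSecond-fixes : ∀ b → b ≢ z → act gen (toSecond b) z ≡ z
    toSecond-sends : ∀ b → b ≢ z → act gen (toSecond b) b ≡ o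

module _ {X : Perm (Fin m) → Set} {z o : Fin m} (certificate : WordCertificate X z o) (id∈X : X (↔-id _))
         (Γ : Graph (Vertex m k)) (base⊆Aut : ∀ g → InBase X g → IsAut Γ g) where
  open WordCertificate certificate

  act-BlockSymmetry : ∀ w → BlockSymmetry Γ (act gen w)
  act-BlockSymmetry []      = (λ _ _ _ → refl) , (λ _ _ _ _ _ → refl)
  act-BlockSymmetry (l ∷ w) =
    BlockSymmetry-∘ Γ (base-BlockSymmetry X id∈X Γ base⊆Aut (gen l) (gen∈X l)) (act-BlockSymmetry w)

  certified-transitive : SymmetriesTransitive Γ z
  certified-transitive a = act gen (toBase a) , act-BlockSymmetry (toBase a) , toBase-sends a

  certified-twoTransitive : SymmetriesTwoTransitive Γ z o
  certified-twoTransitive a b a≢b =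
    act gen w , act-BlockSymmetry w ,
    trans (act-++ gen (toBase a) (toSecond b′) a)
      (trans (cong (act gen (toSecond b′)) (toBase-sends a)) (toSecond-fixes b′ b′≢z)) ,
    trans (act-++ gen (toBase a) (toSecond b′) b) (toSecond-sends b′ b′≢z)
    where
    b′ = act gen (toBase a) b
    b′≢z : b′ ≢ z
    b′≢z eq = a≢b (act-injective gen (toBase a) (trans (toBase-sends a) (sym eq)))
    w = toBase a ++ toSecond b′

Twins : Bool → Graph (Vertex m k) → Vertex m k → Vertex m k → Set
Twins c Γ u v = u ≢ v × (∀ w → withLoops _≟V_ c Γ u w ≡ withLoops _≟V_ c Γ v w)

Twins-image : (Γ : Graph (Vertex m k)) (σ : Perm (Vertex m k)) → IsAut Γ σ → ∀ c {u v} →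
  Twins c Γ u v → Twins c Γ (σ ⟨$⟩ u) (σ ⟨$⟩ v)
Twins-image Γ σ σ-aut c {u} {v} (u≢v , same) = u≢v ∘ ⟨$⟩-injective σ , λ w → begin
  N (σ ⟨$⟩ u) w                   ≡⟨ cong (N (σ ⟨$⟩ u)) (⟨$⟩-⟨$⟩⁻¹ σ w) ⟨
  N (σ ⟨$⟩ u) (σ ⟨$⟩ (σ ⟨$⟩⁻¹ w)) ≡⟨ withLoops-isAut _≟V_ c Γ σ σ-aut u _ ⟩
  N u (σ ⟨$⟩⁻¹ w)                 ≡⟨ same _ ⟩
  N v (σ ⟨$⟩⁻¹ w)                 ≡⟨ withLoops-isAut _≟V_ c Γ σ σ-aut v _ ⟨
  N (σ ⟨$⟩ v) (σ ⟨$⟩ (σ ⟨$⟩⁻¹ w)) ≡⟨ cong (N (σ ⟨$⟩ v)) (⟨$⟩-⟨$⟩⁻¹ σ w) ⟩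
  N (σ ⟨$⟩ v) w                   ∎
  where
  open ≡-Reasoning
  N = withLoops _≟V_ c Γ

module BlockTwins {m k : ℕ} (Γ : Graph (Vertex m k)) (Γ-simple : IsSimple Γ) (z : Fin m)
                  (between : BetweenBlocksConstant z Γ) where

  private
    N : Bool → Graph (Vertex m k)
    N c = withLoops _≟V_ c Γ

    N-self : ∀ c u → N c u u ≡ c
    N-self c u rewrite ⌊⌋-true (u ≟V u) refl | proj₂ Γ-simple u = trans (∨-identityʳ (c ∧ true)) (∧-identityʳ c)

    N-other : ∀ c {u w} → u ≢ w → N c u w ≡ Γ u w
    N-other c = withLoops-other _≟V_ c Γ

  twin-spreads : VertexTransitive Γ → ∀ c {j₀ v} → Twins c Γ (z , j₀) v → ∀ j → Σ (Vertex m k) (Twins c Γ (z , j))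
  twin-spreads Γ-vt c {j₀} {v} twins j with Γ-vt (z , j₀) (z , j)
  ... | σ , σ-aut , σz≡z = σ ⟨$⟩ v , subst (λ u → Twins c Γ u (σ ⟨$⟩ v)) σz≡z (Twins-image Γ σ σ-aut c twins)

  uniform-block-twins : ∀ c j {o} → o ≢ z → (∀ a b → a ≢ b → Γ (a , j) (b , j) ≡ c) → Twins c Γ (z , j) (o , j)
  uniform-block-twins c j {o} o≢z uniform-j = (o≢z ∘ sym ∘ cong proj₁) , λ (δ , i) → same δ i (i ≟F j)
    where
    same : ∀ δ i → Dec (i ≡ j) → N c (z , j) (δ , i) ≡ N c (o , j) (δ , i)
    same δ i (no i≢j) = begin
      N c (z , j) (δ , i)   ≡⟨ N-other c (i≢j ∘ sym ∘ cong proj₂) ⟩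
      Γ (z , j) (δ , i)     ≡⟨ between j i z δ (i≢j ∘ sym) ⟩
      Γ (z , j) (z , i)     ≡⟨ between j i o δ (i≢j ∘ sym) ⟨
      Γ (o , j) (δ , i)     ≡⟨ N-other c (i≢j ∘ sym ∘ cong proj₂) ⟨
      N c (o , j) (δ , i)   ∎
      where open ≡-Reasoning
    same δ .j (yes refl) with δ ≟F z | δ ≟F o
    ... | yes refl | yes δ≡o = ⊥-elim (o≢z (sym δ≡o))
    ... | yes refl | no δ≢o  = trans (N-self c (z , j))
          (trans (sym (uniform-j o z o≢z)) (sym (N-other c (o≢z ∘ cong proj₁))))
    ... | no δ≢z   | yes refl = trans (N-other c (o≢z ∘ sym ∘ cong proj₁))
          (trans (uniform-j z o (o≢z ∘ sym)) (sym (N-self c (o , j))))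
    ... | no δ≢z   | no δ≢o  = trans (N-other c (δ≢z ∘ sym ∘ cong proj₁))
          (trans (uniform-j z δ (δ≢z ∘ sym))
            (sym (trans (N-other c (δ≢o ∘ sym ∘ cong proj₁)) (uniform-j o δ (δ≢o ∘ sym)))))

  twin-in-other-block : ∀ c {j δ i} → i ≢ j → Twins c Γ (z , j) (δ , i) → ∀ b → b ≢ z → Γ (z , j) (b , j) ≡ c
  twin-in-other-block c {j} {δ} {i} i≢j (_ , same) b b≢z = begin
    Γ (z , j) (b , j)      ≡⟨ N-other c (b≢z ∘ sym ∘ cong proj₁) ⟨
    N c (z , j) (b , j)    ≡⟨ same (b , j) ⟩
    N c (δ , i) (b , j)    ≡⟨ N-other c (i≢j ∘ cong proj₂) ⟩
    Γ (δ , i) (b , j)      ≡⟨ between i j δ b i≢j ⟩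
    Γ (z , i) (z , j)      ≡⟨ between i j δ z i≢j ⟨
    Γ (δ , i) (z , j)      ≡⟨ N-other c (i≢j ∘ cong proj₂) ⟨
    N c (δ , i) (z , j)    ≡⟨ same (z , j) ⟨
    N c (z , j) (z , j)    ≡⟨ N-self c (z , j) ⟩
    c                      ∎
    where open ≡-Reasoning

  twin-in-same-block : ∀ c {j δ} → Twins c Γ (z , j) (δ , j) →
    Γ (δ , j) (z , j) ≡ c × (∀ ε → ε ≢ z → ε ≢ δ → Γ (z , j) (ε , j) ≡ Γ (δ , j) (ε , j))
  twin-in-same-block c {j} {δ} (z≢δ , same) =
    trans (sym (N-other c (z≢δ ∘ sym))) (trans (sym (same (z , j))) (N-self c (z , j))) ,
    λ ε ε≢z ε≢δ → trans (sym (N-other c (ε≢z ∘ sym ∘ cong proj₁)))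
                    (trans (same (ε , j)) (N-other c (ε≢δ ∘ sym ∘ cong proj₁)))

  blocks-uniform : VertexTransitive Γ → ∀ {o} → o ≢ z → (j₀ : Fin k) →
    (∀ j a b → a ≢ b → Γ (a , j) (b , j) ≡ Γ (z , j) (o , j)) →
    ∀ j a b → Γ (a , j) (b , j) ≡ uniform (Γ (z , j₀) (o , j₀)) m a b
  blocks-uniform Γ-vt {o} o≢z j₀ within j a b = by-cases (a ≟F b)
    where
    c = Γ (z , j₀) (o , j₀)
    value : ∀ j → Γ (z , j) (o , j) ≡ c
    value j with twin-spreads Γ-vt c (uniform-block-twins c j₀ o≢z (within j₀)) j
    ... | (δ , i) , twins with i ≟F j
    ...   | yes refl =
      trans (sym (within i δ z (proj₁ twins ∘ sym ∘ cong (_, i)))) (proj₁ (twin-in-same-block c twins))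
    ...   | no i≢j   = twin-in-other-block c i≢j twins o o≢z
    by-cases : Dec (a ≡ b) → Γ (a , j) (b , j) ≡ uniform c m a b
    by-cases (yes refl) = trans (proj₂ Γ-simple (a , j)) (sym (proj₂ (uniform-simple c m) a))
    by-cases (no a≢b)   = trans (within j a b a≢b) (trans (value j) (sym (uniform-off-diagonal c a≢b)))

Conclusion₁ : (m k : ℕ) → Graph (Vertex m k) → Set
Conclusion₁ m k Γ = HasMu Γ 2 × Σ ℕ (λ t → Σ (Graph (Fin t)) (λ Θ → IsSimple Θ × VertexTransitive Θ
  × ((Γ ≅ Lex Θ (K m)) ⊎ (Γ ≅ Lex Θ (E m)))))

Conclusion₂ : (k : ℕ) → Graph (Vertex 5 k) → Set
Conclusion₂ k Γ = HasMu Γ 4 × Σ ℕ (λ t → Σ (Graph (Fin t)) (λ Θ → IsSimple Θ × VertexTransitive Θ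
  × (Γ ≅ Lex Θ C5)))

uniform-conclusion : ∀ {m k} (Γ : Graph (Vertex (suc (suc m)) k)) → VertexTransitive Γ → Fin k →
  ∀ c (Θ : Graph (Fin k)) → IsSimple Θ → Γ ≅ Lex Θ (uniform c (suc (suc m))) → Conclusion₁ (suc (suc m)) k Γ
uniform-conclusion Γ Γ-vt j c Θ Θ-simple Γ≅Λ =
  HasMu-≅ Γ≅Λ (HasMu-Lex-uniform c Θ Θ-simple j) ,
  _ , Θ , Θ-simple , LexUniform.vertexTransitive-factor c Θ Θ-simple 0F (VertexTransitive-≅ Γ≅Λ Γ-vt) ,
  K-or-E c Γ≅Λ
  where
  K-or-E : ∀ c → Γ ≅ Lex Θ (uniform c _) → (Γ ≅ Lex Θ (K _)) ⊎ (Γ ≅ Lex Θ (E _))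
  K-or-E true  = inj₁
  K-or-E false = inj₂

C5-conclusion : ∀ {k} (Γ : Graph (Vertex 5 k)) → VertexTransitive Γ → Fin k →
  (Θ : Graph (Fin k)) → IsSimple Θ → Γ ≅ Lex Θ C5 → Conclusion₂ k Γ
C5-conclusion Γ Γ-vt j Θ Θ-simple Γ≅Λ =
  HasMu-≅ Γ≅Λ (HasMu-Lex-C5 j) ,
  _ , Θ , Θ-simple , vertexTransitive-factor (VertexTransitive-≅ Γ≅Λ Γ-vt) , Γ≅Λ
  where open LexC5 Θ Θ-simple

twoTransitive-conclusion : ∀ {m k} (Γ : Graph (Vertex (suc (suc m)) k)) → IsSimple Γ → VertexTransitive Γ → Fin k →
  SymmetriesTransitive Γ 0F → SymmetriesTwoTransitive Γ 0F 1F → Conclusion₁ (suc (suc m)) k Γ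
twoTransitive-conclusion Γ Γ-simple Γ-vt j₀ transitive twoTransitive =
  uniform-conclusion Γ Γ-vt j₀ c (rowGraph 0F Γ) (rowGraph-simple 0F Γ Γ-simple)
    (≅-Lex 0F Γ Γ-simple (uniform c _) (λ _ → ↔-id _)
      (blocks-uniform Γ-vt (λ ()) j₀ (withinBlocksConstant Γ 0F 1F twoTransitive)) between)
  where
  between = betweenBlocksConstant Γ Γ-simple 0F transitive
  open BlockTwins Γ Γ-simple 0F between
  c = Γ (0F , j₀) (1F , j₀)

certified-conclusion : ∀ {m k} {X : Perm (Fin (suc (suc m))) → Set} → WordCertificate X 0F 1F → X (↔-id _) →
  (Γ : Graph (Vertex (suc (suc m)) k)) → IsSimple Γ → VertexTransitive Γ →
  (∀ g → InBase X g → IsAut Γ g) → Fin k → Conclusion₁ (suc (suc m)) k Γ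
certified-conclusion certificate id∈X Γ Γ-simple Γ-vt base⊆Aut j₀ =
  twoTransitive-conclusion Γ Γ-simple Γ-vt j₀
    (certified-transitive certificate id∈X Γ base⊆Aut) (certified-twoTransitive certificate id∈X Γ base⊆Aut)

-- The dihedral group D₅

_+₅_ : Fin 5 → Fin 5 → Fin 5
a +₅ d = (toℕ a + toℕ d) mod 5

abstract
  +₅-negate-cancel : ∀ d a → (a +₅ (negate ⟨$⟩ d)) +₅ d ≡ a
  +₅-negate-cancel = from-yes (all? λ d → all? λ a → ((a +₅ (negate ⟨$⟩ d)) +₅ d) ≟F a)

  +₅-negate-cancelʳ : ∀ d a → (a +₅ d) +₅ (negate ⟨$⟩ d) ≡ a
  +₅-negate-cancelʳ = from-yes (all? λ d → all? λ a → ((a +₅ d) +₅ (negate ⟨$⟩ d)) ≟F a)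

  +₅-negate-self : ∀ a → a +₅ (negate ⟨$⟩ a) ≡ 0F
  +₅-negate-self = from-yes (all? λ a → (a +₅ (negate ⟨$⟩ a)) ≟F 0F)

rotate : Fin 5 → Perm (Fin 5)
rotate d = mk↔ₛ′ (_+₅ d) (_+₅ (negate ⟨$⟩ d)) (+₅-negate-cancel d) (+₅-negate-cancelʳ d)

abstract
  rotate∈D5 : ∀ d → D5 (rotate d)
  rotate∈D5 d = 1F , d , inj₁ refl ,
    from-yes (all? λ d → all? λ x → toℕ (x +₅ d) ≟ℕ (1 * toℕ x + toℕ d) % 5) d

  negate∈D5 : D5 negate
  negate∈D5 = 4F , 0F , inj₂ refl , from-yes (all? λ x → toℕ (negate ⟨$⟩ x) ≟ℕ (4 * toℕ x + 0) % 5)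

  id∈D5 : D5 (↔-id _)
  id∈D5 = 1F , 0F , inj₁ refl , from-yes (all? λ (x : Fin 5) → toℕ x ≟ℕ (1 * toℕ x + 0) % 5)

-- The graphs on 𝔽₅ invariant under D₅: adjacency of a and b depends only on ±(b - a).
byDifference : Bool → Bool → Fin 5 → Bool
byDifference α β 0F = false
byDifference α β 1F = α
byDifference α β 2F = β
byDifference α β 3F = β
byDifference α β 4F = α

circulant : Bool → Bool → Graph (Fin 5)
circulant α β a b = byDifference α β (b +₅ (negate ⟨$⟩ a))

times3 : Perm (Fin 5)
times3 = mk↔ₛ′ triple halve
  (from-yes (all? λ a → triple (halve a) ≟F a)) (from-yes (all? λ a → halve (triple a) ≟F a))
  where
  triple halve : Fin 5 → Fin 5
  triple 0F = 0F
  triple 1F = 3F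
  triple 2F = 1F
  triple 3F = 4F
  triple 4F = 2F
  halve 0F = 0F
  halve 1F = 2F
  halve 2F = 4F
  halve 3F = 1F
  halve 4F = 3F

C5-relabelling : Bool → Perm (Fin 5)
C5-relabelling true  = ↔-id _
C5-relabelling false = times3

abstract
  circulant-uniform : ∀ c a b → circulant c c a b ≡ uniform c 5 a b
  circulant-uniform = from-yes (∀-Bool? λ c → all? λ a → all? λ b → circulant c c a b ≟B uniform c 5 a b)

  circulant-C5 : ∀ α a b → circulant α (not α) a b ≡ C5 (C5-relabelling α ⟨$⟩ a) (C5-relabelling α ⟨$⟩ b)
  circulant-C5 = from-yes (∀-Bool? λ α → all? λ a → all? λ b →
    circulant α (not α) a b ≟B C5 (C5-relabelling α ⟨$⟩ a) (C5-relabelling α ⟨$⟩ b))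

  circulant-twins : ∀ α β c δ → δ ≢ 0F → circulant α β δ 0F ≡ c →
    (∀ ε → ε ≢ 0F → ε ≢ δ → circulant α β 0F ε ≡ circulant α β δ ε) → α ≡ c × β ≡ c
  circulant-twins = from-yes (∀-Bool? λ α → ∀-Bool? λ β → ∀-Bool? λ c → all? λ δ →
    ¬? (δ ≟F 0F) →-dec (circulant α β δ 0F ≟B c) →-dec
    (all? λ ε → ¬? (ε ≟F 0F) →-dec ¬? (ε ≟F δ) →-dec (circulant α β 0F ε ≟B circulant α β δ ε)) →-dec
    ((α ≟B c) ×-dec (β ≟B c)))

module D5Blocks {k : ℕ} (Γ : Graph (Vertex 5 k)) (Γ-simple : IsSimple Γ)
                (base⊆Aut : ∀ g → InBase D5 g → IsAut Γ g) where

  symmetry : ∀ x → D5 x → BlockSymmetry Γ (x ⟨$⟩_)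
  symmetry = base-BlockSymmetry D5 id∈D5 Γ base⊆Aut

  transitive : SymmetriesTransitive Γ 0F
  transitive a = rotate (negate ⟨$⟩ a) ⟨$⟩_ , symmetry (rotate (negate ⟨$⟩ a)) (rotate∈D5 _) , +₅-negate-self a

  between : BetweenBlocksConstant 0F Γ
  between = betweenBlocksConstant Γ Γ-simple 0F transitive

  α β : Fin k → Bool
  α j = Γ (0F , j) (1F , j)
  β j = Γ (0F , j) (2F , j)

  blocks-circulant : ∀ j a b → Γ (a , j) (b , j) ≡ circulant (α j) (β j) a b
  blocks-circulant j a b = begin
    Γ (a , j) (b , j)                   ≡⟨ proj₁ (symmetry (rotate a⁻) (rotate∈D5 a⁻)) j a b ⟨
    Γ (a +₅ a⁻ , j) (b +₅ a⁻ , j)       ≡⟨ cong (λ x → Γ (x , j) (b +₅ a⁻ , j)) (+₅-negate-self a) ⟩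
    Γ (0F , j) (b +₅ a⁻ , j)            ≡⟨ row (b +₅ a⁻) ⟩
    circulant (α j) (β j) a b           ∎
    where
    open ≡-Reasoning
    a⁻ = negate ⟨$⟩ a
    reflected : ∀ d → Γ (0F , j) (negate ⟨$⟩ d , j) ≡ Γ (0F , j) (d , j)
    reflected = proj₁ (symmetry negate negate∈D5) j 0F
    row : ∀ d → Γ (0F , j) (d , j) ≡ byDifference (α j) (β j) d
    row 0F = proj₂ Γ-simple (0F , j)
    row 1F = refl
    row 2F = refl
    row 3F = sym (reflected 3F)
    row 4F = sym (reflected 4F)

  open BlockTwins Γ Γ-simple 0F between

  uniform-spreads : VertexTransitive Γ → ∀ j₁ → α j₁ ≡ β j₁ → ∀ j → α j ≡ α j₁ × β j ≡ α j₁
  uniform-spreads Γ-vt j₁ α≡β j with twin-spreads Γ-vt (α j₁) (uniform-block-twins (α j₁) j₁ {1F} (λ ()) uniform₁) j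
    where
    uniform₁ : ∀ a b → a ≢ b → Γ (a , j₁) (b , j₁) ≡ α j₁
    uniform₁ a b a≢b = trans (blocks-circulant j₁ a b)
      (trans (cong (λ y → circulant (α j₁) y a b) (sym α≡β))
      (trans (circulant-uniform (α j₁) a b) (uniform-off-diagonal (α j₁) a≢b)))
  ... | (δ , i) , twins with i ≟F j
  ...   | yes refl with twin-in-same-block (α j₁) twins
  ...     | toward-0 , sees-alike = circulant-twins (α i) (β i) (α j₁) δ (proj₁ twins ∘ sym ∘ cong (_, i))
              (trans (sym (blocks-circulant i δ 0F)) toward-0)
              λ ε ε≢0 ε≢δ → trans (sym (blocks-circulant i 0F ε))
                              (trans (sees-alike ε ε≢0 ε≢δ) (blocks-circulant i δ ε))
  uniform-spreads Γ-vt j₁ α≡β j | (δ , i) , twins | no i≢j =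
    twin-in-other-block (α j₁) i≢j twins 1F (λ ()) , twin-in-other-block (α j₁) i≢j twins 2F (λ ())

  classification : VertexTransitive Γ → Fin k → Conclusion₁ 5 k Γ ⊎ Conclusion₂ k Γ
  classification Γ-vt j₀ with α j₀ ≟B β j₀
  ... | yes α≡β = inj₁ (uniform-conclusion Γ Γ-vt j₀ (α j₀) (rowGraph 0F Γ) (rowGraph-simple 0F Γ Γ-simple)
                     (≅-Lex 0F Γ Γ-simple (uniform (α j₀) 5) (λ _ → ↔-id _) within between))
    where
    within : ∀ j a b → Γ (a , j) (b , j) ≡ uniform (α j₀) 5 a b
    within j a b with uniform-spreads Γ-vt j₀ α≡β j
    ... | αj≡ , βj≡ = trans (blocks-circulant j a b)
          (trans (cong₂ (λ x y → circulant x y a b) αj≡ βj≡) (circulant-uniform (α j₀) a b))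
  ... | no α≢β = inj₂ (C5-conclusion Γ Γ-vt j₀ (rowGraph 0F Γ) (rowGraph-simple 0F Γ Γ-simple)
                     (≅-Lex 0F Γ Γ-simple C5 (C5-relabelling ∘ α) within between))
    where
    complementary : ∀ j → β j ≡ not (α j)
    complementary j with α j ≟B β j
    ... | yes αj≡βj = ⊥-elim (α≢β (trans (proj₁ spread) (sym (proj₂ spread))))
      where spread = uniform-spreads Γ-vt j αj≡βj j₀
    ... | no αj≢βj = not-≢ αj≢βj
      where
      not-≢ : ∀ {a b} → a ≢ b → b ≡ not a
      not-≢ {false} {false} a≢b = ⊥-elim (a≢b refl)
      not-≢ {false} {true}  _   = refl
      not-≢ {true}  {false} _   = refl
      not-≢ {true}  {true}  a≢b = ⊥-elim (a≢b refl)
    within : ∀ j a b → Γ (a , j) (b , j) ≡ C5 (C5-relabelling (α j) ⟨$⟩ a) (C5-relabelling (α j) ⟨$⟩ b)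
    within j a b = trans (blocks-circulant j a b)
      (trans (cong (λ y → circulant (α j) y a b) (complementary j)) (circulant-C5 (α j) a b))

-- The groups PSL₂(5), PGL₃(2) and AGL₃(2)

preimage : ∀ {n} → (Fin n → Fin n) → Fin n → Fin n
preimage f y with any? (λ x → f x ≟F y)
... | yes (x , _) = x
... | no _        = y

permutation : ∀ {n} (f : Fin n → Fin n) →
  {_ : True (all? λ y → f (preimage f y) ≟F y)} → {_ : True (all? λ x → preimage f (f x) ≟F x)} → Perm (Fin n)
permutation f {onto} {into} = mk↔ₛ′ f (preimage f) (toWitness onto) (toWitness into)

induces? : ∀ a b c d σ → Dec (Induces2 a b c d σ)
induces? a b c d σ = all? λ p →
  let x = proj₁ (repPL p) ; y = proj₂ (repPL p)
      x′ = proj₁ (repPL (σ ⟨$⟩ p)) ; y′ = proj₂ (repPL (σ ⟨$⟩ p)) in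
  any? λ l → ¬? (toℕ l ≟ℕ 0) ×-dec ((a * x + b * y) % 5 ≟ℕ (toℕ l * x′) % 5)
                              ×-dec ((c * x + d * y) % 5 ≟ℕ (toℕ l * y′) % 5)

-- x ↦ x + 1 and x ↦ -1/x on the projective line, where 5 stands for ∞.
psl-shift psl-invert : Perm (Fin 6)
psl-shift  = permutation λ { 0F → 1F ; 1F → 2F ; 2F → 3F ; 3F → 4F ; 4F → 0F ; 5F → 5F }
psl-invert = permutation λ { 0F → 5F ; 1F → 4F ; 2F → 2F ; 3F → 3F ; 4F → 1F ; 5F → 0F }

abstract
  psl-shift∈ : PSL25 psl-shift
  psl-shift∈ = 1F , 1F , 0F , 1F , refl , from-yes (induces? 1 1 0 1 psl-shift)

  psl-invert∈ : PSL25 psl-invert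
  psl-invert∈ = 0F , 4F , 1F , 0F , refl , from-yes (induces? 0 4 1 0 psl-invert)

  psl-id∈ : PSL25 (↔-id _)
  psl-id∈ = 1F , 0F , 0F , 1F , refl , from-yes (induces? 1 0 0 1 (↔-id _))

psl-generator : Fin 2 → Perm (Fin 6)
psl-generator 0F = psl-shift
psl-generator 1F = psl-invert

psl-toBase psl-toSecond : Fin 6 → List (Fin 2)
psl-toBase 0F = []
psl-toBase 1F = 1F ∷ 0F ∷ []
psl-toBase 2F = 0F ∷ 0F ∷ 0F ∷ []
psl-toBase 3F = 0F ∷ 0F ∷ []
psl-toBase 4F = 0F ∷ []
psl-toBase 5F = 1F ∷ []
psl-toSecond 0F = []
psl-toSecond 1F = []
psl-toSecond 2F = 1F ∷ 0F ∷ 0F ∷ 1F ∷ []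
psl-toSecond 3F = 1F ∷ 0F ∷ 1F ∷ []
psl-toSecond 4F = 1F ∷ 0F ∷ 0F ∷ 0F ∷ 1F ∷ []
psl-toSecond 5F = 0F ∷ 1F ∷ 0F ∷ []

psl-certificate : WordCertificate PSL25 0F 1F
psl-certificate = record
  { Letter = Fin 2 ; gen = psl-generator ; gen∈X = λ { 0F → psl-shift∈ ; 1F → psl-invert∈ }
  ; toBase = psl-toBase ; toBase-sends = sends
  ; toSecond = psl-toSecond ; toSecond-fixes = fixes ; toSecond-sends = sends₂ }
  where
  abstract
    sends : ∀ a → act psl-generator (psl-toBase a) a ≡ 0F
    sends = from-yes (all? λ a → act psl-generator (psl-toBase a) a ≟F 0F)
    fixes : ∀ b → b ≢ 0F → act psl-generator (psl-toSecond b) 0F ≡ 0F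
    fixes = from-yes (all? λ b → ¬? (b ≟F 0F) →-dec (act psl-generator (psl-toSecond b) 0F ≟F 0F))
    sends₂ : ∀ b → b ≢ 0F → act psl-generator (psl-toSecond b) b ≡ 1F
    sends₂ = from-yes (all? λ b → ¬? (b ≟F 0F) →-dec (act psl-generator (psl-toSecond b) b ≟F 1F))

matrix : (r₀ r₁ r₂ : Fin 3 → Fin 2) → Mat3
matrix r₀ r₁ r₂ 0F = r₀
matrix r₀ r₁ r₂ 1F = r₁
matrix r₀ r₁ r₂ 2F = r₂

row : (a b c : Fin 2) → Fin 3 → Fin 2
row a b c 0F = a
row a b c 1F = b
row a b c 2F = c

M₀ M₁ I₃ : Mat3
M₀ = matrix (row 0F 0F 1F) (row 0F 1F 0F) (row 1F 1F 0F)
M₁ = matrix (row 0F 1F 1F) (row 0F 0F 1F) (row 1F 0F 1F)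
I₃ = matrix (row 1F 0F 0F) (row 0F 1F 0F) (row 0F 0F 1F)

permutes-fano? : (M : Mat3) (σ : Perm (Fin 7)) → Dec (∀ p r → fano (σ ⟨$⟩ p) r ≡ mulv M (fano p) r % 2)
permutes-fano? M σ = all? λ p → all? λ r → fano (σ ⟨$⟩ p) r ≟ℕ mulv M (fano p) r % 2

-- The permutations of the Fano plane induced by M₀ and M₁, which generate GL₃(2).
pgl-generator : Fin 2 → Perm (Fin 7)
pgl-generator 0F = permutation λ { 0F → 3F ; 1F → 5F ; 2F → 1F ; 3F → 0F ; 4F → 4F ; 5F → 6F ; 6F → 2F }
pgl-generator 1F = permutation λ { 0F → 3F ; 1F → 0F ; 2F → 4F ; 3F → 6F ; 4F → 2F ; 5F → 5F ; 6F → 1F }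

pgl-toBase pgl-toSecond : Fin 7 → List (Fin 2)
pgl-toBase 0F = []
pgl-toBase 1F = 1F ∷ []
pgl-toBase 2F = 0F ∷ 1F ∷ []
pgl-toBase 3F = 0F ∷ []
pgl-toBase 4F = 1F ∷ 0F ∷ 1F ∷ []
pgl-toBase 5F = 0F ∷ 1F ∷ 1F ∷ []
pgl-toBase 6F = 1F ∷ 1F ∷ []
pgl-toSecond 0F = []
pgl-toSecond 1F = []
pgl-toSecond 2F = 1F ∷ 0F ∷ 1F ∷ 0F ∷ []
pgl-toSecond 3F = 0F ∷ 1F ∷ 1F ∷ 1F ∷ []
pgl-toSecond 4F = 1F ∷ 0F ∷ []
pgl-toSecond 5F = 1F ∷ 0F ∷ 0F ∷ 0F ∷ []
pgl-toSecond 6F = 0F ∷ 0F ∷ []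

abstract
  pgl-id∈ : PGL32 (↔-id _)
  pgl-id∈ = I₃ , (λ ()) , from-yes (permutes-fano? I₃ (↔-id _))

  pgl-generator∈ : ∀ l → PGL32 (pgl-generator l)
  pgl-generator∈ 0F = M₀ , (λ ()) , from-yes (permutes-fano? M₀ (pgl-generator 0F))
  pgl-generator∈ 1F = M₁ , (λ ()) , from-yes (permutes-fano? M₁ (pgl-generator 1F))

pgl-certificate : WordCertificate PGL32 0F 1F
pgl-certificate = record
  { Letter = Fin 2 ; gen = pgl-generator ; gen∈X = pgl-generator∈
  ; toBase = pgl-toBase ; toBase-sends = sends
  ; toSecond = pgl-toSecond ; toSecond-fixes = fixes ; toSecond-sends = sends₂ }
  where
  abstract
    sends : ∀ a → act pgl-generator (pgl-toBase a) a ≡ 0F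
    sends = from-yes (all? λ a → act pgl-generator (pgl-toBase a) a ≟F 0F)
    fixes : ∀ b → b ≢ 0F → act pgl-generator (pgl-toSecond b) 0F ≡ 0F
    fixes = from-yes (all? λ b → ¬? (b ≟F 0F) →-dec (act pgl-generator (pgl-toSecond b) 0F ≟F 0F))
    sends₂ : ∀ b → b ≢ 0F → act pgl-generator (pgl-toSecond b) b ≡ 1F
    sends₂ = from-yes (all? λ b → ¬? (b ≟F 0F) →-dec (act pgl-generator (pgl-toSecond b) b ≟F 1F))

permutes-affine? : (M : Mat3) (b : Fin 3 → Fin 2) (σ : Perm (Fin 8)) →
  Dec (∀ p r → vec8 (σ ⟨$⟩ p) r ≡ (mulv M (vec8 p) r + toℕ (b r)) % 2)
permutes-affine? M b σ = all? λ p → all? λ r → vec8 (σ ⟨$⟩ p) r ≟ℕ (mulv M (vec8 p) r + toℕ (b r)) % 2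

-- The translation by (1, 0, 0) and the linear maps M₀ and M₁.
agl-generator : Fin 3 → Perm (Fin 8)
agl-generator 0F = permutation λ { 0F → 1F ; 1F → 0F ; 2F → 3F ; 3F → 2F ; 4F → 5F ; 5F → 4F ; 6F → 7F ; 7F → 6F }
agl-generator 1F = permutation λ { 0F → 0F ; 1F → 4F ; 2F → 6F ; 3F → 2F ; 4F → 1F ; 5F → 5F ; 6F → 7F ; 7F → 3F }
agl-generator 2F = permutation λ { 0F → 0F ; 1F → 4F ; 2F → 1F ; 3F → 5F ; 4F → 7F ; 5F → 3F ; 6F → 6F ; 7F → 2F }

agl-toBase agl-toSecond : Fin 8 → List (Fin 3)
agl-toBase 0F = []
agl-toBase 1F = 0F ∷ []
agl-toBase 2F = 2F ∷ 0F ∷ []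
agl-toBase 3F = 0F ∷ 2F ∷ 0F ∷ []
agl-toBase 4F = 1F ∷ 0F ∷ []
agl-toBase 5F = 0F ∷ 1F ∷ 0F ∷ []
agl-toBase 6F = 0F ∷ 2F ∷ 2F ∷ 0F ∷ []
agl-toBase 7F = 2F ∷ 2F ∷ 0F ∷ []
agl-toSecond 0F = []
agl-toSecond 1F = []
agl-toSecond 2F = 2F ∷ []
agl-toSecond 3F = 1F ∷ 2F ∷ []
agl-toSecond 4F = 1F ∷ []
agl-toSecond 5F = 2F ∷ 1F ∷ 2F ∷ []
agl-toSecond 6F = 1F ∷ 2F ∷ 2F ∷ []
agl-toSecond 7F = 2F ∷ 2F ∷ []

abstract
  agl-id∈ : AGL32 (↔-id _)
  agl-id∈ = I₃ , (λ ()) , (λ _ → 0F) , from-yes (permutes-affine? I₃ (λ _ → 0F) (↔-id _))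

  agl-generator∈ : ∀ l → AGL32 (agl-generator l)
  agl-generator∈ 0F = I₃ , (λ ()) , row 1F 0F 0F , from-yes (permutes-affine? I₃ (row 1F 0F 0F) (agl-generator 0F))
  agl-generator∈ 1F = M₀ , (λ ()) , (λ _ → 0F) , from-yes (permutes-affine? M₀ (λ _ → 0F) (agl-generator 1F))
  agl-generator∈ 2F = M₁ , (λ ()) , (λ _ → 0F) , from-yes (permutes-affine? M₁ (λ _ → 0F) (agl-generator 2F))

agl-certificate : WordCertificate AGL32 0F 1F
agl-certificate = record
  { Letter = Fin 3 ; gen = agl-generator ; gen∈X = agl-generator∈
  ; toBase = agl-toBase ; toBase-sends = sends
  ; toSecond = agl-toSecond ; toSecond-fixes = fixes ; toSecond-sends = sends₂ }
  where
  abstract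
    sends : ∀ a → act agl-generator (agl-toBase a) a ≡ 0F
    sends = from-yes (all? λ a → act agl-generator (agl-toBase a) a ≟F 0F)
    fixes : ∀ b → b ≢ 0F → act agl-generator (agl-toSecond b) 0F ≡ 0F
    fixes = from-yes (all? λ b → ¬? (b ≟F 0F) →-dec (act agl-generator (agl-toSecond b) 0F ≟F 0F))
    sends₂ : ∀ b → b ≢ 0F → act agl-generator (agl-toSecond b) b ≡ 1F
    sends₂ = from-yes (all? λ b → ¬? (b ≟F 0F) →-dec (act agl-generator (agl-toSecond b) b ≟F 1F))

-- Alternating groups

-- The 3-cycle (i  i+1  i+2).
cycle3 : ℕ → ℕ → ℕ
cycle3 zero    0       = 1
cycle3 zero    1       = 2
cycle3 zero    2       = 0
cycle3 zero    x       = x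
cycle3 (suc i) zero    = zero
cycle3 (suc i) (suc x) = suc (cycle3 i x)

cycle3-cubed : ∀ i x → cycle3 i (cycle3 i (cycle3 i x)) ≡ x
cycle3-cubed zero    0               = refl
cycle3-cubed zero    1               = refl
cycle3-cubed zero    2               = refl
cycle3-cubed zero    (suc (suc (suc x))) = refl
cycle3-cubed (suc i) zero            = refl
cycle3-cubed (suc i) (suc x)         = cong suc (cycle3-cubed i x)

cycle3-< : ∀ {N} i x → suc (suc i) < N → x < N → cycle3 i x < N
cycle3-< zero 0 i<N x<N = <-trans (n<1+n 1) i<N
cycle3-< zero 1 i<N x<N = i<N
cycle3-< zero 2 i<N x<N = <-trans (s≤s z≤n) i<N
cycle3-< zero (suc (suc (suc x))) i<N x<N = x<N
cycle3-< (suc i) zero i<N x<N = x<N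
cycle3-< {suc N} (suc i) (suc x) (s≤s i<N) (s≤s x<N) = s≤s (cycle3-< i x i<N x<N)

cycle3-inversion : ∀ i {x y} → x < y → cycle3 i y < cycle3 i x → (x ≡ i ⊎ x ≡ suc i) × y ≡ suc (suc i)
cycle3-inversion zero {0} {1} x<y (s≤s ())
cycle3-inversion zero {0} {2} x<y _ = inj₁ refl , refl
cycle3-inversion zero {0} {suc (suc (suc y))} x<y (s≤s ())
cycle3-inversion zero {1} {2} x<y _ = inj₂ refl , refl
cycle3-inversion zero {1} {suc (suc (suc y))} x<y (s≤s (s≤s ()))
cycle3-inversion zero {2} {suc (suc (suc y))} x<y ()
cycle3-inversion zero {1} {1} (s≤s ()) _
cycle3-inversion zero {suc (suc (suc x))} {1} (s≤s ()) _
cycle3-inversion zero {suc (suc (suc x))} {2} (s≤s (s≤s ())) _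
cycle3-inversion zero {suc (suc (suc x))} {suc (suc (suc y))} x<y y<x = ⊥-elim (<-asym x<y y<x)
cycle3-inversion (suc i) {zero} {suc y} x<y ()
cycle3-inversion (suc i) {suc x} {suc y} (s≤s x<y) (s≤s y<x) with cycle3-inversion i x<y y<x
... | inj₁ refl , refl = inj₁ refl , refl
... | inj₂ refl , refl = inj₂ refl , refl

cycle3-at : ∀ i → cycle3 i i ≡ suc i × cycle3 i (suc i) ≡ suc (suc i) × cycle3 i (suc (suc i)) ≡ i
cycle3-at zero    = refl , refl , refl
cycle3-at (suc i) with cycle3-at i
... | p , q , r = cong suc p , cong suc q , cong suc r

-- (a-2  a-1  a) takes a to a-2, and (0 1 2) applied twice takes 1 to 0.
toZero : ℕ → List ℕ
toZero 0             = []
toZero 1             = 0 ∷ 0 ∷ []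
toZero (suc (suc a)) = a ∷ toZero a

cycles : List ℕ → ℕ → ℕ
cycles []      x = x
cycles (i ∷ w) x = cycles w (cycle3 i x)

cycles-toZero : ∀ a → cycles (toZero a) a ≡ 0
cycles-toZero 0             = refl
cycles-toZero 1             = refl
cycles-toZero (suc (suc a)) = trans (cong (cycles (toZero a)) (proj₂ (proj₂ (cycle3-at a)))) (cycles-toZero a)

cycles-shift : ∀ w x → cycles (map suc w) (suc x) ≡ suc (cycles w x)
cycles-shift []      x = refl
cycles-shift (i ∷ w) x = cycles-shift w (cycle3 i x)

cycles-shift-0 : ∀ w → cycles (map suc w) 0 ≡ 0
cycles-shift-0 []      = refl
cycles-shift-0 (i ∷ w) = cycles-shift-0 w

toZero-bounded : ∀ {N} a → 3 ≤ N → a < N → All (λ i → suc (suc i) < N) (toZero a)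
toZero-bounded 0             _   _   = []
toZero-bounded 1             3≤N _   = 3≤N ∷ 3≤N ∷ []
toZero-bounded (suc (suc a)) 3≤N a<N = a<N ∷ toZero-bounded a 3≤N (<-trans (n<1+n a) (<-trans (n<1+n (suc a)) a<N))

module Alternating (n : ℕ) where

  private
    M : ℕ
    M = suc (suc (suc (suc n)))

  cyclePerm : (i : ℕ) → suc (suc i) < M → Perm (Fin M)
  cyclePerm i i+2<M = mk↔ₛ′ c (c ∘ c) cubed cubed
    where
    c : Fin M → Fin M
    c x = fromℕ< (cycle3-< i (toℕ x) i+2<M (toℕ<n x))
    cubed : ∀ x → c (c (c x)) ≡ x
    cubed x = toℕ-injective (begin
      toℕ (c (c (c x)))                      ≡⟨ toℕ-fromℕ< _ ⟩
      cycle3 i (toℕ (c (c x)))               ≡⟨ cong (cycle3 i) (toℕ-fromℕ< _) ⟩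
      cycle3 i (cycle3 i (toℕ (c x)))        ≡⟨ cong (cycle3 i ∘ cycle3 i) (toℕ-fromℕ< _) ⟩
      cycle3 i (cycle3 i (cycle3 i (toℕ x))) ≡⟨ cycle3-cubed i (toℕ x) ⟩
      toℕ x                                  ∎)
      where open ≡-Reasoning

  toℕ-cyclePerm : ∀ i i+2<M x → toℕ (cyclePerm i i+2<M ⟨$⟩ x) ≡ cycle3 i (toℕ x)
  toℕ-cyclePerm i i+2<M x = toℕ-fromℕ< _

  private
    isInversion : Perm (Fin M) → Fin M × Fin M → Bool
    isInversion σ (x , y) = ⌊ toℕ x <?ℕ toℕ y ⌋ ∧ ⌊ toℕ (σ ⟨$⟩ y) <?ℕ toℕ (σ ⟨$⟩ x) ⌋

    inverted? : (σ : Perm (Fin M)) (q : Fin M × Fin M) → Dec (isInversion σ q ≡ true)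
    inverted? σ q = isInversion σ q ≟B true

    pairs : List (Fin M × Fin M)
    pairs = cartesianProduct (allFin M) (allFin M)

    pairs-unique : Unique pairs
    pairs-unique = cartesianProduct⁺ (allFin⁺ M) (allFin⁺ M)

    inversion-sound : ∀ σ {x y} → (x , y) ∈ filter (inverted? σ) pairs →
      toℕ x < toℕ y × toℕ (σ ⟨$⟩ y) < toℕ (σ ⟨$⟩ x)
    inversion-sound σ {x} {y} xy∈ with proj₂ (∈-filter⁻ (inverted? σ) {xs = pairs} xy∈)
    ... | inverted with toℕ x <?ℕ toℕ y | toℕ (σ ⟨$⟩ y) <?ℕ toℕ (σ ⟨$⟩ x)
    ...   | yes x<y | yes σy<σx = x<y , σy<σx

    inversion-complete : ∀ σ {x y} → toℕ x < toℕ y → toℕ (σ ⟨$⟩ y) < toℕ (σ ⟨$⟩ x) →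
      (x , y) ∈ filter (inverted? σ) pairs
    inversion-complete σ {x} {y} x<y σy<σx =
      ∈-filter⁺ (inverted? σ) (∈-cartesianProduct⁺ (∈-allFin x) (∈-allFin y)) inverted
      where
      inverted : isInversion σ (x , y) ≡ true
      inverted rewrite ⌊⌋-true (toℕ x <?ℕ toℕ y) x<y | ⌊⌋-true (toℕ (σ ⟨$⟩ y) <?ℕ toℕ (σ ⟨$⟩ x)) σy<σx = refl

  inversions-id : inversions (↔-id (Fin M)) ≡ 0
  inversions-id = n≤0⇒n≡0 (Unique-length-≤ (filter⁺ (inverted? (↔-id _)) pairs-unique) none)
    where
    none : ∀ {q} → q ∈ filter (inverted? (↔-id _)) pairs → q ∈ []
    none q∈ with inversion-sound (↔-id _) q∈
    ... | x<y , y<x = ⊥-elim (<-asym x<y y<x)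

  module CycleInversions (i : ℕ) (i+2<M : suc (suc i) < M) where
    private
      σ : Perm (Fin M)
      σ = cyclePerm i i+2<M
      i<M : i < M
      i<M = <-trans (n<1+n i) (<-trans (n<1+n (suc i)) i+2<M)
      i+1<M : suc i < M
      i+1<M = <-trans (n<1+n (suc i)) i+2<M

    inverted-pairs : List (Fin M × Fin M)
    inverted-pairs = (fromℕ< i<M , fromℕ< i+2<M) ∷ (fromℕ< i+1<M , fromℕ< i+2<M) ∷ []

    inverted-pairs-unique : Unique inverted-pairs
    inverted-pairs-unique = (distinct ∷ []) ∷ [] ∷ []
      where
      distinct : (fromℕ< i<M , fromℕ< i+2<M) ≢ (fromℕ< i+1<M , fromℕ< i+2<M)
      distinct eq = <-irrefl (trans (sym (toℕ-fromℕ< i<M)) (trans (cong (toℕ ∘ proj₁) eq) (toℕ-fromℕ< i+1<M)))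
                             (n<1+n i)

    only-inverted-pairs : ∀ {q} → q ∈ filter (inverted? σ) pairs → q ∈ inverted-pairs
    only-inverted-pairs {x , y} q∈ with inversion-sound σ q∈
    ... | x<y , σy<σx
      with cycle3-inversion i x<y (subst₂ _<_ (toℕ-cyclePerm i i+2<M y) (toℕ-cyclePerm i i+2<M x) σy<σx)
    ... | inj₁ x≡i   , y≡i+2 = here (cong₂ _,_ (toℕ-injective (trans x≡i (sym (toℕ-fromℕ< i<M))))
                                                (toℕ-injective (trans y≡i+2 (sym (toℕ-fromℕ< i+2<M)))))
    ... | inj₂ x≡i+1 , y≡i+2 = there (here (cong₂ _,_ (toℕ-injective (trans x≡i+1 (sym (toℕ-fromℕ< i+1<M))))
                                                       (toℕ-injective (trans y≡i+2 (sym (toℕ-fromℕ< i+2<M))))))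

    private
      σ-at : ∀ {x} (x<M : x < M) → toℕ (σ ⟨$⟩ fromℕ< x<M) ≡ cycle3 i x
      σ-at x<M = trans (toℕ-cyclePerm i i+2<M _) (cong (cycle3 i) (toℕ-fromℕ< x<M))

      inverted-with-last : ∀ {x} (x<M : x < M) → x < suc (suc i) → i < cycle3 i x →
        (fromℕ< x<M , fromℕ< i+2<M) ∈ filter (inverted? σ) pairs
      inverted-with-last x<M x<i+2 i<σx = inversion-complete σ
        (subst₂ _<_ (sym (toℕ-fromℕ< x<M)) (sym (toℕ-fromℕ< i+2<M)) x<i+2)
        (subst₂ _<_ (sym (trans (σ-at i+2<M) (proj₂ (proj₂ (cycle3-at i))))) (sym (σ-at x<M)) i<σx)

    inverted-pairs-inverted : ∀ {q} → q ∈ inverted-pairs → q ∈ filter (inverted? σ) pairs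
    inverted-pairs-inverted (here refl)         = inverted-with-last i<M (<-trans (n<1+n i) (n<1+n (suc i)))
      (subst (i <_) (sym (proj₁ (cycle3-at i))) (n<1+n i))
    inverted-pairs-inverted (there (here refl)) = inverted-with-last i+1<M (n<1+n (suc i))
      (subst (i <_) (sym (proj₁ (proj₂ (cycle3-at i)))) (<-trans (n<1+n i) (n<1+n (suc i))))

  inversions-cyclePerm : ∀ i i+2<M → inversions (cyclePerm i i+2<M) ≡ 2
  inversions-cyclePerm i i+2<M = ≤-antisym
    (Unique-length-≤ (filter⁺ (inverted? (cyclePerm i i+2<M)) pairs-unique) only-inverted-pairs)
    (Unique-length-≤ inverted-pairs-unique inverted-pairs-inverted)
    where open CycleInversions i i+2<M

  id∈Alt : AltG M (↔-id _)
  id∈Alt = cong (_% 2) inversions-id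

  -- The identity when the 3-cycle does not fit into Fin M, so that words are plain lists of ℕ.
  cycleOrId : ℕ → Perm (Fin M)
  cycleOrId i with suc (suc i) <?ℕ M
  ... | yes i+2<M = cyclePerm i i+2<M
  ... | no _      = ↔-id _

  cycleOrId∈Alt : ∀ i → AltG M (cycleOrId i)
  cycleOrId∈Alt i with suc (suc i) <?ℕ M
  ... | yes i+2<M = cong (_% 2) (inversions-cyclePerm i i+2<M)
  ... | no _      = id∈Alt

  toℕ-cycleOrId : ∀ i → suc (suc i) < M → ∀ x → toℕ (cycleOrId i ⟨$⟩ x) ≡ cycle3 i (toℕ x)
  toℕ-cycleOrId i i+2<M x with suc (suc i) <?ℕ M
  ... | yes i+2<M′ = toℕ-cyclePerm i i+2<M′ x
  ... | no i+2≮M   = ⊥-elim (i+2≮M i+2<M)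

  toℕ-act : ∀ w → All (λ i → suc (suc i) < M) w → ∀ x → toℕ (act cycleOrId w x) ≡ cycles w (toℕ x)
  toℕ-act []      []                x = refl
  toℕ-act (i ∷ w) (i+2<M ∷ bounded) x =
    trans (toℕ-act w bounded (cycleOrId i ⟨$⟩ x)) (cong (cycles w) (toℕ-cycleOrId i i+2<M x))

  alt-certificate : WordCertificate (AltG M) 0F 1F
  alt-certificate = record
    { Letter = ℕ ; gen = cycleOrId ; gen∈X = cycleOrId∈Alt
    ; toBase = toBase ; toBase-sends = toBase-sends
    ; toSecond = toSecond ; toSecond-fixes = toSecond-fixes ; toSecond-sends = toSecond-sends }
    where
    toBase toSecond : Fin M → List ℕ
    toBase a   = toZero (toℕ a)
    toSecond b = map suc (toZero (pred (toℕ b)))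

    toBase-bounded : ∀ a → All (λ i → suc (suc i) < M) (toBase a)
    toBase-bounded a = toZero-bounded (toℕ a) (s≤s (s≤s (s≤s z≤n))) (toℕ<n a)

    toSecond-bounded : ∀ b → All (λ i → suc (suc i) < M) (toSecond b)
    toSecond-bounded 0F          = []
    toSecond-bounded (Fin.suc b) = All.map⁺ (All.map s≤s (toZero-bounded (toℕ b) (s≤s (s≤s (s≤s z≤n))) (toℕ<n b)))

    toBase-sends : ∀ a → act cycleOrId (toBase a) a ≡ 0F
    toBase-sends a = toℕ-injective (trans (toℕ-act _ (toBase-bounded a) a) (cycles-toZero (toℕ a)))

    toSecond-fixes : ∀ b → b ≢ 0F → act cycleOrId (toSecond b) 0F ≡ 0F
    toSecond-fixes b _ =
      toℕ-injective (trans (toℕ-act _ (toSecond-bounded b) 0F) (cycles-shift-0 (toZero (pred (toℕ b)))))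

    toSecond-sends : ∀ b → b ≢ 0F → act cycleOrId (toSecond b) b ≡ 1F
    toSecond-sends 0F          b≢0 = ⊥-elim (b≢0 refl)
    toSecond-sends (Fin.suc b) _   = toℕ-injective (begin
      toℕ (act cycleOrId (toSecond (Fin.suc b)) (Fin.suc b))  ≡⟨ toℕ-act _ (toSecond-bounded (Fin.suc b)) _ ⟩
      cycles (map suc (toZero (toℕ b))) (suc (toℕ b))         ≡⟨ cycles-shift (toZero (toℕ b)) (toℕ b) ⟩
      suc (cycles (toZero (toℕ b)) (toℕ b))                   ≡⟨ cong suc (cycles-toZero (toℕ b)) ⟩
      1                                                        ∎)
      where open ≡-Reasoning

-- The five admissible triples

theorem3p9 : (m k : ℕ) (X Y : Perm (Fin m) → Set) → Triple m X Y → 1 ≤ k →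
    (Γ : Graph (Fin m × Fin k)) → IsSimple Γ → VertexTransitive Γ →
    (G : Perm (Fin m × Fin k) → Set) → IsPermGroup G →
    (∀ g → G g → IsAut Γ g) →
    (∀ g → InBase X g → G g) →
    (∀ g → G g → InWreath Y g) →
    (HasMu Γ 2 × Σ ℕ (λ t → Σ (Graph (Fin t)) (λ Θ → IsSimple Θ × VertexTransitive Θ
        × ((Γ ≅ Lex Θ (K m)) ⊎ (Γ ≅ Lex Θ (E m))))))
    ⊎ (HasMu Γ 4 × Σ ℕ (λ t → Σ (Graph (Fin t)) (λ Θ → IsSimple Θ × VertexTransitive Θ
        × (Γ ≅ Lex Θ C5))))
theorem3p9 _ k _ _ (alt-sym (s≤s (s≤s (s≤s (s≤s {n = n} _))))) 1≤k Γ Γ-simple Γ-vt G _ G⊆Aut base⊆G _ =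
  inj₁ (certified-conclusion (Alternating.alt-certificate n) (Alternating.id∈Alt n) Γ Γ-simple Γ-vt
          (λ g g∈ → G⊆Aut g (base⊆G g g∈)) (fromℕ< 1≤k))
theorem3p9 _ k _ _ d5-agl 1≤k Γ Γ-simple Γ-vt G _ G⊆Aut base⊆G _ =
  D5Blocks.classification Γ Γ-simple (λ g g∈ → G⊆Aut g (base⊆G g g∈)) Γ-vt (fromℕ< 1≤k)
theorem3p9 _ k _ _ psl-pgl 1≤k Γ Γ-simple Γ-vt G _ G⊆Aut base⊆G _ =
  inj₁ (certified-conclusion psl-certificate psl-id∈ Γ Γ-simple Γ-vt (λ g g∈ → G⊆Aut g (base⊆G g g∈)) (fromℕ< 1≤k))
theorem3p9 _ k _ _ pgl-pgl 1≤k Γ Γ-simple Γ-vt G _ G⊆Aut base⊆G _ =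
  inj₁ (certified-conclusion pgl-certificate pgl-id∈ Γ Γ-simple Γ-vt (λ g g∈ → G⊆Aut g (base⊆G g g∈)) (fromℕ< 1≤k))
theorem3p9 _ k _ _ agl-agl 1≤k Γ Γ-simple Γ-vt G _ G⊆Aut base⊆G _ =
  inj₁ (certified-conclusion agl-certificate agl-id∈ Γ Γ-simple Γ-vt (λ g g∈ → G⊆Aut g (base⊆G g g∈)) (fromℕ< 1≤k))
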